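{- Let $E$ be a finite set and let $f$ be a symmetric submodular function from the subsets of $E$ to the integers. Then there is a tree-decomposition $(T,(P_t\mid t\in V(T)))$ of $E$ distinguishing any two maximal tangles efficiently such that in each of its parts $P_t$ lives a maximal tangle.
   Context: $f:2^E\to\mathbb Z$ is symmetric if $f(X)=f(E\setminus X)$ for all $X$, and submodular if $f(X)+f(Y)\ge f(X\cap Y)+f(X\cup Y)$ for all $X,Y\subseteq E$. A separation is an ordered bipartition $(A,B)$ of $E$; its order is $o(A,B)=f(A)=f(B)$. A tangle of order $k+1$ is a choice, for every separation $(A,B)$ of order at most $k$, of exactly one of its sides as "small" (consistently for $(A,B)$ and $(B,A)$), such that no three small sides (not necessarily distinct) have union $E$, and such that $E\setminus\{e\}$ is never small for $e\in E$; complements of small sets are called big. A tangle is maximal if it is not properly contained (as a collection of small sets) in any other tangle. A separation distinguishes two tangles if both assign a small side to it and they pick different small sides; it does so efficiently if it has minimal order among all separations distinguishing them. A tree-decomposition is a tree $T$ with a partition $(P_t\mid t\in V(T))$ of $E$ into possibly empty classes; for $X\subseteq V(T)$ put $S(X)=\bigcup_{t\in X}P_t$; for an edge $e$ of $T$ with components $X,Y$ of $T-e$, the separations corresponding to $e$ are $(S(X),S(Y))$ and $(S(Y),S(X))$. The tree-decomposition distinguishes two tangles efficiently if some separation corresponding to an edge of $T$ distinguishes them efficiently. For an edge $tu$ of $T$ let $S_t$ (resp. $S_u$) denote $S(X_t)$ (resp. $S(X_u)$), where $X_t$, $X_u$ are the components of $T-tu$ containing $t$, $u$. A tangle $\mathcal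 Q$ lives in a nonempty subgraph $S$ of $T$ if for every $t\in V(S)$ and every edge $tu$ of $T$ incident with $t$ but not in $S$, the set $S_t$ is big in $\mathcal Q$; there is a smallest subgraph $S(\mathcal Q)$ in which $\mathcal Q$ lives, and $\mathcal Q$ lives in the part $P_t$ if $S(\mathcal Q)$ consists of the single vertex $t$ (equivalently, for every edge $tu$ of $T$ at $t$, $S_t$ is big in $\mathcal Q$). -}

module Defs where

open import Data.Nat as ℕ using (ℕ; zero; suc)
open import Data.Integer using (ℤ; _+_; _≤_)
open import Data.Bool using (Bool; true; false)
open import Data.Fin using (Fin; zero; suc; toℕ; _≟_)
open import Data.Fin.Subset using (Subset; _∪_; _∩_; ∁; ⊤; ⁅_⁆)
open import Data.Vec using (tabulate)
open import Data.List using (upTo)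
open import Data.Bool.ListAction using (any)
open import Data.Product using (Σ; ∃; _×_)
open import Data.Sum using (_⊎_)
open import Relation.Nullary using (¬_; does)
open import Relation.Binary.PropositionalEquality using (_≡_)

-- The ground set E is Fin n; subsets of E are Data.Fin.Subset.Subset n.
-- A separation (A , E∖A) is represented by its first side A.

Symmetric : {n : ℕ} → (Subset n → ℤ) → Set
Symmetric f = ∀ X → f X ≡ f (∁ X)

Submodular : {n : ℕ} → (Subset n → ℤ) → Set
Submodular f = ∀ X Y → f (X ∩ Y) + f (X ∪ Y) ≤ f X + f Y

-- A collection of "small" sets, given by its (decidable) indicator.
Collection : ℕ → Set
Collection n = Subset n → Bool

Small : {n : ℕ} → Collection n → Subset n → Set
Small 𝒮 A = 𝒮 A ≡ true

Big : {n : ℕ} → Collection n → Subset n → Set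
Big 𝒮 A = Small 𝒮 (∁ A)

-- 𝒮 is a tangle of order k+1 for f.
record IsTangle {n : ℕ} (f : Subset n → ℤ) (k : ℤ) (𝒮 : Collection n) : Set where
  field
    small-order : ∀ A → Small 𝒮 A → f A ≤ k
    orient      : ∀ A → f A ≤ k → Small 𝒮 A ⊎ Small 𝒮 (∁ A)
    exclusive   : ∀ A → ¬ (Small 𝒮 A × Small 𝒮 (∁ A))
    no-cover    : ∀ A B C → Small 𝒮 A → Small 𝒮 B → Small 𝒮 C → ¬ ((A ∪ B) ∪ C ≡ ⊤)
    co-singleton : ∀ e → ¬ Small 𝒮 (∁ ⁅ e ⁆)

IsTangleAny : {n : ℕ} → (Subset n → ℤ) → Collection n → Set
IsTangleAny f 𝒮 = ∃ λ k → IsTangle f k 𝒮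

_⊆ᶜ_ : {n : ℕ} → Collection n → Collection n → Set
𝒮 ⊆ᶜ 𝒮' = ∀ A → Small 𝒮 A → Small 𝒮' A

_⊂ᶜ_ : {n : ℕ} → Collection n → Collection n → Set
𝒮 ⊂ᶜ 𝒮' = 𝒮 ⊆ᶜ 𝒮' × ∃ λ A → Small 𝒮' A × ¬ Small 𝒮 A

IsMaximalTangle : {n : ℕ} → (Subset n → ℤ) → Collection n → Set
IsMaximalTangle f 𝒮 = IsTangleAny f 𝒮 × (∀ 𝒮' → IsTangleAny f 𝒮' → ¬ (𝒮 ⊂ᶜ 𝒮'))

Distinguishes : {n : ℕ} → Subset n → Collection n → Collection n → Set
Distinguishes A 𝒫 𝒬 =
  (Small 𝒫 A × Small 𝒬 (∁ A)) ⊎ (Small 𝒫 (∁ A) × Small 𝒬 A)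

DistinguishesEfficiently : {n : ℕ} → (Subset n → ℤ) → Subset n → Collection n → Collection n → Set
DistinguishesEfficiently f A 𝒫 𝒬 =
  Distinguishes A 𝒫 𝒬 × (∀ B → Distinguishes B 𝒫 𝒬 → f A ≤ f B)

-- Finite trees: vertex set Fin (suc m), rooted at zero; vertex suc i has
-- parent par i with toℕ (par i) ≤ toℕ i.  Every finite nonempty tree arises
-- this way (up to relabelling); edges are {suc i , par i} for i : Fin m.
record TreeDecomposition (n : ℕ) : Set where
  field
    m      : ℕ
    par    : Fin m → Fin (suc m)
    par<   : ∀ i → toℕ (par i) ℕ.≤ toℕ i
    part   : Fin n → Fin (suc m)   -- element e lies in the part P_(part e)

  parentF : Fin (suc m) → Fin (suc m)
  parentF zero    = zero
  parentF (suc i) = par i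

  iter : ℕ → Fin (suc m) → Fin (suc m)
  iter zero    v = v
  iter (suc k) v = parentF (iter k v)

  isAnc : Fin (suc m) → Fin (suc m) → Bool
  isAnc u v = any (λ k → does (iter k v ≟ u)) (upTo (suc m))

  -- For the edge e_i = {suc i , par i}: S(X_{suc i}) where X_{suc i} is the
  -- component of T - e_i containing suc i (the subtree below suc i).
  below : Fin m → Subset n
  below i = tabulate (λ x → isAnc (suc i) (part x))

  EdgeSeparation : Subset n → Set
  EdgeSeparation A = ∃ λ i → (A ≡ below i) ⊎ (A ≡ ∁ (below i))

  -- 𝒬 lives in the part P_t: for every edge tu at t, S_t is big.
  LivesIn : Collection n → Fin (suc m) → Set
  LivesIn 𝒬 t =
    (∀ i → suc i ≡ t → Big 𝒬 (below i)) ×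
    (∀ i → par i ≡ t → Big 𝒬 (∁ (below i)))

  DistinguishesEfficientlyTD : (Subset n → ℤ) → Collection n → Collection n → Set
  DistinguishesEfficientlyTD f 𝒫 𝒬 =
    ∃ λ A → EdgeSeparation A × DistinguishesEfficiently f A 𝒫 𝒬

-- Distinct maximal tangles are distinguished by some separation. Build a nested family N greedily:
-- take a cheapest separation B₀ distinguishing a pair of maximal tangles that N does not yet
-- distinguish efficiently, and uncross it with each member of N it crosses. Submodularity and the
-- minimality of the orders involved keep the order at most f B₀, and by the fish lemma every
-- uncrossing step strictly reduces the number of crossings; so the result S is nested with N and
-- distinguishes the pair efficiently. Representing each separation by its side avoiding a fixed
-- point makes N laminar, hence the edge set of a tree, and the two tangles oriented by S (in
-- which S is small and big respectively) provide the tangles living in the parts on either side.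

module Submission where

module Separations where

  open import Data.Nat using (ℕ; suc)
  open import Data.Bool.Properties using (not-involutive)
  open import Data.Fin using (Fin; zero)
  open import Data.Fin.Subset using (Subset; _∈_; _∉_; _⊆_; _⊂_; ∁; _∪_; _∩_; ⊤)
  open import Data.Fin.Subset.Properties
    using ( _∈?_; _⊆?_; ⊆-antisym; ⊆⊤; p⊆p∪q; q⊆p∪q; p∩q⊆p; p∩q⊆q; x∈p∩q⁺
          ; x∉p⇒x∈∁p; x∈∁p⇒x∉p; x∉∁p⇒x∈p; x∈p⇒x∉∁p; p⊆q⇒∁p⊇∁q; ∁p⊆∁q⇒p⊇q)
  open import Data.Fin.Properties using (any?)
  open import Data.Vec using ([]; _∷_)
  open import Data.Product using (_,_)
  open import Data.Sum using (_⊎_; inj₁; inj₂; [_,_])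
  open import Data.Empty using (⊥-elim)
  open import Function using (_∘_; id)
  open import Relation.Nullary using (¬_; Dec; yes; no)
  open import Relation.Nullary.Decidable using (_⊎-dec_; ¬?; _×-dec_)
  open import Relation.Binary.PropositionalEquality using (_≡_; _≢_; refl; cong₂; subst)

  private variable
    n : ℕ
    x : Fin n
    A B C T U X Y Z : Subset n

  ∁-involutive : (p : Subset n) → ∁ (∁ p) ≡ p
  ∁-involutive []      = refl
  ∁-involutive (s ∷ p) = cong₂ _∷_ (not-involutive s) (∁-involutive p)

  ∈-or-∈∁ : (x : Fin n) (p : Subset n) → x ∈ p ⊎ x ∈ ∁ p
  ∈-or-∈∁ x p with x ∈? p
  ... | yes x∈p = inj₁ x∈p
  ... | no  x∉p = inj₂ (x∉p⇒x∈∁p x∉p)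

  covers⇒∪≡⊤ : (∀ x → x ∈ A ⊎ x ∈ B ⊎ x ∈ C) → (A ∪ B) ∪ C ≡ ⊤
  covers⇒∪≡⊤ {A = A} {B} {C} cover = ⊆-antisym ⊆⊤ λ {x} _ →
    [ inAB ∘ p⊆p∪q B , [ inAB ∘ q⊆p∪q A B , q⊆p∪q (A ∪ B) C ] ] (cover x)
    where
    inAB : x ∈ A ∪ B → x ∈ (A ∪ B) ∪ C
    inAB = p⊆p∪q C

  ⊆∧⊉⇒⊂ : A ⊆ B → ¬ B ⊆ A → A ⊂ B
  ⊆∧⊉⇒⊂ {A = A} {B} A⊆B B⊈A with any? (λ x → x ∈? B ×-dec ¬? (x ∈? A))
  ... | yes (x , x∈B , x∉A) = A⊆B , x , x∈B , x∉A
  ... | no  none = ⊥-elim (B⊈A λ x∈B → x∉∁p⇒x∈p λ x∈∁A → none (_ , x∈B , x∈∁p⇒x∉p x∈∁A))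

  ⊆∧≢⇒⊂ : A ⊆ B → A ≢ B → A ⊂ B
  ⊆∧≢⇒⊂ A⊆B A≢B = ⊆∧⊉⇒⊂ A⊆B (A≢B ∘ ⊆-antisym A⊆B)

  ∁p⊆q⇒∁q⊆p : ∁ A ⊆ B → ∁ B ⊆ A
  ∁p⊆q⇒∁q⊆p ∁A⊆B x∈∁B = x∉∁p⇒x∈p λ x∈∁A → x∈∁p⇒x∉p x∈∁B (∁A⊆B x∈∁A)

  p⊆∁q⇒q⊆∁p : A ⊆ ∁ B → B ⊆ ∁ A
  p⊆∁q⇒q⊆∁p A⊆∁B x∈B = x∉p⇒x∈∁p λ x∈A → x∈∁p⇒x∉p (A⊆∁B x∈A) x∈B

  Nested : Subset n → Subset n → Set
  Nested A B = A ⊆ B ⊎ A ⊆ ∁ B ⊎ ∁ A ⊆ B ⊎ ∁ A ⊆ ∁ B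

  Crosses : Subset n → Subset n → Set
  Crosses A B = ¬ Nested A B

  nested? : (A B : Subset n) → Dec (Nested A B)
  nested? A B = A ⊆? B ⊎-dec A ⊆? ∁ B ⊎-dec ∁ A ⊆? B ⊎-dec ∁ A ⊆? ∁ B

  nested-refl : Nested A A
  nested-refl = inj₁ λ x∈A → x∈A

  nested-sym : Nested A B → Nested B A
  nested-sym (inj₁ A⊆B)               = inj₂ (inj₂ (inj₂ (p⊆q⇒∁p⊇∁q A⊆B)))
  nested-sym (inj₂ (inj₁ A⊆∁B))        = inj₂ (inj₁ (p⊆∁q⇒q⊆∁p A⊆∁B))
  nested-sym (inj₂ (inj₂ (inj₁ ∁A⊆B)))  = inj₂ (inj₂ (inj₁ (∁p⊆q⇒∁q⊆p ∁A⊆B)))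
  nested-sym (inj₂ (inj₂ (inj₂ ∁A⊆∁B))) = inj₁ (∁p⊆∁q⇒p⊇q ∁A⊆∁B)

  nested-∁ˡ : Nested A B → Nested (∁ A) B
  nested-∁ˡ {A = A} (inj₁ A⊆B)               = inj₂ (inj₂ (inj₁ (A⊆B ∘ subst (_ ∈_) (∁-involutive A))))
  nested-∁ˡ {A = A} (inj₂ (inj₁ A⊆∁B))        = inj₂ (inj₂ (inj₂ (A⊆∁B ∘ subst (_ ∈_) (∁-involutive A))))
  nested-∁ˡ         (inj₂ (inj₂ (inj₁ ∁A⊆B)))  = inj₁ ∁A⊆B
  nested-∁ˡ         (inj₂ (inj₂ (inj₂ ∁A⊆∁B))) = inj₂ (inj₁ ∁A⊆∁B)

  nested-∁ʳ : Nested A B → Nested A (∁ B)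
  nested-∁ʳ = nested-sym ∘ nested-∁ˡ ∘ nested-sym

  nested-∁ˡ⁻ : Nested (∁ A) B → Nested A B
  nested-∁ˡ⁻ {A = A} {B} = subst (λ Z → Nested Z B) (∁-involutive A) ∘ nested-∁ˡ

  nested-∩ : Crosses X Y → Nested U X → Nested U Y → Nested U (X ∩ Y)
  nested-∩ {X = X} {Y} {U} X⋈Y = corner
    where
    outX : ∀ {x} → x ∈ ∁ X → x ∈ ∁ (X ∩ Y)
    outX x∈∁X = x∉p⇒x∈∁p (x∈∁p⇒x∉p x∈∁X ∘ p∩q⊆p X Y)
    outY : ∀ {x} → x ∈ ∁ Y → x ∈ ∁ (X ∩ Y)
    outY x∈∁Y = x∉p⇒x∈∁p (x∈∁p⇒x∉p x∈∁Y ∘ p∩q⊆q X Y)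
    corner : Nested U X → Nested U Y → Nested U (X ∩ Y)
    corner (inj₂ (inj₁ U⊆∁X))        _ = inj₂ (inj₁ (outX ∘ U⊆∁X))
    corner (inj₂ (inj₂ (inj₂ ∁U⊆∁X))) _ = inj₂ (inj₂ (inj₂ (outX ∘ ∁U⊆∁X)))
    corner _ (inj₂ (inj₁ U⊆∁Y))        = inj₂ (inj₁ (outY ∘ U⊆∁Y))
    corner _ (inj₂ (inj₂ (inj₂ ∁U⊆∁Y))) = inj₂ (inj₂ (inj₂ (outY ∘ ∁U⊆∁Y)))
    corner (inj₁ U⊆X) (inj₁ U⊆Y) = inj₁ λ x∈U → x∈p∩q⁺ (U⊆X x∈U , U⊆Y x∈U)
    corner (inj₂ (inj₂ (inj₁ ∁U⊆X))) (inj₂ (inj₂ (inj₁ ∁U⊆Y))) =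
      inj₂ (inj₂ (inj₁ λ x∈∁U → x∈p∩q⁺ (∁U⊆X x∈∁U , ∁U⊆Y x∈∁U)))
    corner (inj₁ U⊆X) (inj₂ (inj₂ (inj₁ ∁U⊆Y))) =
      ⊥-elim (X⋈Y (inj₂ (inj₂ (inj₁ (∁U⊆Y ∘ p⊆q⇒∁p⊇∁q U⊆X)))))
    corner (inj₂ (inj₂ (inj₁ ∁U⊆X))) (inj₁ U⊆Y) =
      ⊥-elim (X⋈Y (inj₂ (inj₂ (inj₁ (U⊆Y ∘ ∁p⊆q⇒∁q⊆p ∁U⊆X)))))

  nested⇒laminar : ∀ {m} {A B : Subset (suc m)} → zero ∉ A → zero ∉ B → Nested A B →
    A ⊆ B ⊎ B ⊆ A ⊎ (∀ {x} → x ∈ A → x ∉ B)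
  nested⇒laminar 0∉A 0∉B (inj₁ A⊆B)               = inj₁ A⊆B
  nested⇒laminar 0∉A 0∉B (inj₂ (inj₁ A⊆∁B))        = inj₂ (inj₂ (x∈∁p⇒x∉p ∘ A⊆∁B))
  nested⇒laminar 0∉A 0∉B (inj₂ (inj₂ (inj₁ ∁A⊆B)))  = ⊥-elim (0∉B (∁A⊆B (x∉p⇒x∈∁p 0∉A)))
  nested⇒laminar 0∉A 0∉B (inj₂ (inj₂ (inj₂ ∁A⊆∁B))) = inj₂ (inj₁ (∁p⊆∁q⇒p⊇q ∁A⊆∁B))

  Corner : Subset n → Subset n → Subset n → Set
  Corner X Y Z = Z ≡ X ∩ Y ⊎ Z ≡ ∁ X ∩ Y

  corner⊆ : Corner X Y Z → Z ⊆ Y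
  corner⊆ {X = X} {Y} (inj₁ refl) = p∩q⊆q X Y
  corner⊆ {X = X} {Y} (inj₂ refl) = p∩q⊆q (∁ X) Y

  nested-corner : Crosses X Y → Nested U X → Nested U Y → Corner X Y Z → Nested U Z
  nested-corner X⋈Y U∥X U∥Y (inj₁ refl) = nested-∩ X⋈Y U∥X U∥Y
  nested-corner X⋈Y U∥X U∥Y (inj₂ refl) = nested-∩ (X⋈Y ∘ nested-∁ˡ⁻) (nested-∁ʳ U∥X) U∥Y

  IsSide : Subset n → Subset n → Set
  IsSide T Y = Y ≡ T ⊎ Y ≡ ∁ T

  nested-side⁺ : IsSide T Y → Nested U T → Nested U Y
  nested-side⁺ (inj₁ refl) = id
  nested-side⁺ (inj₂ refl) = nested-∁ʳ

  nested-side⁻ : IsSide T Y → Nested U Y → Nested U T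
  nested-side⁻ (inj₁ refl) = id
  nested-side⁻ (inj₂ refl) = nested-sym ∘ nested-∁ˡ⁻ ∘ nested-sym

  crosses-side : IsSide T Y → ¬ Nested T X → Crosses X Y
  crosses-side side T⋈X = T⋈X ∘ nested-sym ∘ nested-side⁻ side

  ⊆-side⇒nested : IsSide T Y → Z ⊆ Y → Nested T Z
  ⊆-side⇒nested (inj₁ refl) Z⊆T  = nested-sym (inj₁ Z⊆T)
  ⊆-side⇒nested (inj₂ refl) Z⊆∁T = nested-sym (inj₂ (inj₁ Z⊆∁T))

module FiniteSearch where

  open import Data.Nat using (ℕ; zero; suc; _≤_; _<_; z≤n; s≤s)
  open import Data.Nat.Properties using (m≤n⇒m≤1+n; ≤-trans; n≤1+n)
  open import Data.Bool using (Bool; true; false)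
  open import Data.List using (List; []; _∷_; map; _++_; cartesianProductWith)
  open import Data.List.Membership.Propositional using (_∈_; find; lose)
  open import Data.List.Membership.Propositional.Properties
    using (∈-map⁺; ∈-++⁺ˡ; ∈-++⁺ʳ; ∈-cartesianProductWith⁺)
  open import Data.List.Relation.Unary.Any using (here; there; any?)
  open import Data.List.Relation.Unary.All as All using (all?)
  open import Data.Fin.Subset using (Subset; inside; outside)
  open import Data.Fin.Subset.Properties using (anySubset?)
  open import Data.Vec using ([]; _∷_)
  open import Data.Product using (∃; _×_; _,_)
  open import Data.Sum using (_⊎_; inj₁; inj₂)
  open import Data.Empty using (⊥-elim)
  open import Function using (_∘_)
  open import Level using (0ℓ)
  open import Relation.Nullary using (¬_; Dec; yes; no)
  open import Relation.Nullary.Decidable using (map′; ¬?; decidable-stable)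
  open import Relation.Unary using (Pred; Decidable)
  open import Relation.Binary.PropositionalEquality using (_≗_; refl)

  private variable
    A : Set
    n : ℕ

  module _ {P : Pred A 0ℓ} (P? : Decidable P) where

    count : List A → ℕ
    count []       = 0
    count (x ∷ xs) with P? x
    ... | yes _ = suc (count xs)
    ... | no  _ = count xs

  module _ {P Q : Pred A 0ℓ} (P? : Decidable P) (Q? : Decidable Q) where

    count-mono : (xs : List A) → (∀ {x} → x ∈ xs → P x → Q x) → count P? xs ≤ count Q? xs
    count-mono []       P⇒Q = z≤n
    count-mono (x ∷ xs) P⇒Q with P? x | Q? x
    ... | yes _  | yes _  = s≤s (count-mono xs (P⇒Q ∘ there))
    ... | yes px | no ¬qx = ⊥-elim (¬qx (P⇒Q (here refl) px))
    ... | no _   | yes _  = m≤n⇒m≤1+n (count-mono xs (P⇒Q ∘ there))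
    ... | no _   | no _   = count-mono xs (P⇒Q ∘ there)

    count-mono-< : (xs : List A) → (∀ {x} → x ∈ xs → P x → Q x) →
      ∀ {y} → y ∈ xs → ¬ P y → Q y → count P? xs < count Q? xs
    count-mono-< (x ∷ xs) P⇒Q (here refl) ¬py qy with P? x | Q? x
    ... | yes px | _      = ⊥-elim (¬py px)
    ... | no _   | yes _  = s≤s (count-mono xs (P⇒Q ∘ there))
    ... | no _   | no ¬qy = ⊥-elim (¬qy qy)
    count-mono-< (x ∷ xs) P⇒Q (there y∈xs) ¬py qy with P? x | Q? x
    ... | yes _  | yes _  = s≤s (count-mono-< xs (P⇒Q ∘ there) y∈xs ¬py qy)
    ... | yes px | no ¬qx = ⊥-elim (¬qx (P⇒Q (here refl) px))
    ... | no _   | yes _  = ≤-trans (count-mono-< xs (P⇒Q ∘ there) y∈xs ¬py qy) (n≤1+n _)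
    ... | no _   | no _   = count-mono-< xs (P⇒Q ∘ there) y∈xs ¬py qy

  ∃-∈? : {P : Pred A 0ℓ} → Decidable P → (xs : List A) → Dec (∃ λ x → x ∈ xs × P x)
  ∃-∈? P? xs = map′ find (λ (_ , x∈xs , px) → lose x∈xs px) (any? P? xs)

  ∀-∈? : {P : Pred A 0ℓ} → Decidable P → (xs : List A) → Dec (∀ {x} → x ∈ xs → P x)
  ∀-∈? P? xs = map′ All.lookup All.tabulate (all? P? xs)

  module Minimum (R : A → A → Set) (total : ∀ x y → R x y ⊎ R y x) (trans′ : ∀ {x y z} → R x y → R y z → R x z) where

    private
      refl′ : ∀ x → R x x
      refl′ x with total x x
      ... | inj₁ r = r
      ... | inj₂ r = r

    Minimal : Pred A 0ℓ → List A → A → Set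
    Minimal P xs x = x ∈ xs × P x × (∀ {y} → y ∈ xs → P y → R x y)

    minimal? : {P : Pred A 0ℓ} → Decidable P → (xs : List A) → (∀ {y} → y ∈ xs → ¬ P y) ⊎ ∃ (Minimal P xs)
    minimal? P? [] = inj₁ λ ()
    minimal? P? (z ∷ zs) with minimal? P? zs | P? z
    ... | inj₁ none | no ¬pz = inj₁ λ { (here refl) → ¬pz ; (there y∈) → none y∈ }
    ... | inj₁ none | yes pz = inj₂ (z , here refl , pz , λ { (here refl) _ → refl′ z ; (there y∈) py → ⊥-elim (none y∈ py) })
    ... | inj₂ (x , x∈ , px , min) | no ¬pz =
      inj₂ (x , there x∈ , px , λ { (here refl) pz → ⊥-elim (¬pz pz) ; (there y∈) py → min y∈ py })
    ... | inj₂ (x , x∈ , px , min) | yes pz with total z x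
    ...   | inj₁ z≤x = inj₂ (z , here refl , pz , λ { (here refl) _ → refl′ z ; (there y∈) py → trans′ z≤x (min y∈ py) })
    ...   | inj₂ x≤z = inj₂ (x , there x∈ , px , λ { (here refl) _ → x≤z ; (there y∈) py → min y∈ py })

    minimal : {P : Pred A 0ℓ} → Decidable P → (xs : List A) → ∀ {x} → x ∈ xs → P x → ∃ (Minimal P xs)
    minimal P? xs x∈xs px with minimal? P? xs
    ... | inj₁ none = ⊥-elim (none x∈xs px)
    ... | inj₂ min  = min

  subsets : (n : ℕ) → List (Subset n)
  subsets zero    = [] ∷ []
  subsets (suc n) = map (inside ∷_) (subsets n) ++ map (outside ∷_) (subsets n)

  ∈-subsets : (p : Subset n) → p ∈ subsets n
  ∈-subsets []                  = here refl
  ∈-subsets (true  ∷ p)         = ∈-++⁺ˡ (∈-map⁺ (inside ∷_) (∈-subsets p))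
  ∈-subsets {suc n} (false ∷ p) = ∈-++⁺ʳ (map (inside ∷_) (subsets n)) (∈-map⁺ (outside ∷_) (∈-subsets p))

  ∀-Subset? : {P : Pred (Subset n) 0ℓ} → Decidable P → Dec (∀ p → P p)
  ∀-Subset? P? with anySubset? (¬? ∘ P?)
  ... | yes (p , ¬Pp) = no λ all → ¬Pp (all p)
  ... | no  ¬∃       = yes λ p → decidable-stable (P? p) (¬∃ ∘ (p ,_))

  predicates : (n : ℕ) → List (Subset n → Bool)
  predicates zero    = (λ _ → true) ∷ (λ _ → false) ∷ []
  predicates (suc n) = cartesianProductWith join (predicates n) (predicates n)
    where
    join : (Subset n → Bool) → (Subset n → Bool) → Subset (suc n) → Bool
    join φ ψ (true  ∷ p) = φ p
    join φ ψ (false ∷ p) = ψ p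

  predicates-complete : (φ : Subset n → Bool) → ∃ λ ψ → ψ ∈ predicates n × φ ≗ ψ
  predicates-complete {zero} φ with φ [] in φ[]
  ... | true  = _ , here refl , λ { [] → φ[] }
  ... | false = _ , there (here refl) , λ { [] → φ[] }
  predicates-complete {suc n} φ with predicates-complete (φ ∘ (inside ∷_)) | predicates-complete (φ ∘ (outside ∷_))
  ... | (ψ₁ , ψ₁∈ , φ≗ψ₁) | (ψ₂ , ψ₂∈ , φ≗ψ₂) =
    _ , ∈-cartesianProductWith⁺ _ ψ₁∈ ψ₂∈ , λ { (true ∷ p) → φ≗ψ₁ p ; (false ∷ p) → φ≗ψ₂ p }

module Tangles where

  open import Data.Nat using (ℕ)
  open import Data.Integer using (ℤ; _+_; _≤_; _≤?_)
  open import Data.Integer.Properties using (≤-trans; ≤⇒≯; ≰⇒>; <⇒≤; +-mono-<-≤)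
  open import Data.Bool using (true)
  import Data.Bool.Properties as Bool
  open import Data.Fin.Subset using (Subset; _∈_; _⊆_; ∁; _∪_; _∩_)
  open import Data.Fin.Subset.Properties using (p∩q⊆p; q⊆p∪q; x∉p⇒x∈∁p; x∈∁p⇒x∉p; x∈p⇒x∉∁p; x∈p∪q⁻; x∈p∩q⁺)
  open import Data.Product using (∃; _×_; _,_)
  open import Data.Sum using (_⊎_; inj₁; inj₂; [_,_]′)
  open import Data.Empty using (⊥; ⊥-elim)
  open import Function using (_∘_)
  open import Relation.Nullary using (¬_; Dec; yes; no)
  open import Relation.Nullary.Decidable using (_×-dec_; _⊎-dec_)
  open import Relation.Binary.PropositionalEquality using (refl; sym; subst)
  open import Defs
  open Separations

  private variable
    n : ℕ
    A B X Y : Subset n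
    𝒫 𝒬 : Collection n

  +-cancel-≤ : ∀ {a b c d : ℤ} → a + b ≤ c + d → d ≤ b → a ≤ c
  +-cancel-≤ {a} {b} {c} {d} a+b≤c+d d≤b with a ≤? c
  ... | yes a≤c = a≤c
  ... | no  a≰c = ⊥-elim (≤⇒≯ a+b≤c+d (+-mono-<-≤ (≰⇒> a≰c) d≤b))

  submodular-∩ : (f : Subset n → ℤ) → Submodular f → ∀ X Y → f Y ≤ f (X ∪ Y) → f (X ∩ Y) ≤ f X
  submodular-∩ f submodular X Y = +-cancel-≤ (submodular X Y)

  small? : (𝒮 : Collection n) (A : Subset n) → Dec (Small 𝒮 A)
  small? 𝒮 A = 𝒮 A Bool.≟ true

  Small⇒Big∁ : (𝒮 : Collection n) → Small 𝒮 A → Big 𝒮 (∁ A)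
  Small⇒Big∁ {A = A} 𝒮 = subst (Small 𝒮) (sym (∁-involutive A))

  module Tangle {f : Subset n → ℤ} (symmetric : Symmetric f) {k : ℤ} {𝒮 : Collection n} (T : IsTangle f k 𝒮) where
    open IsTangle T

    Small⇒≤ : Small 𝒮 A → f A ≤ k
    Small⇒≤ = small-order _

    Big⇒≤ : Big 𝒮 A → f A ≤ k
    Big⇒≤ {A = A} big = subst (_≤ k) (sym (symmetric A)) (small-order (∁ A) big)

    small-or-big : f A ≤ k → Small 𝒮 A ⊎ Big 𝒮 A
    small-or-big = orient _

    small∧big⇒⊥ : Small 𝒮 A → Big 𝒮 A → ⊥
    small∧big⇒⊥ small big = exclusive _ (small , big)

    uncovered : ∀ {A B C} → Small 𝒮 A → Small 𝒮 B → Small 𝒮 C → ¬ (∀ x → x ∈ A ⊎ x ∈ B ⊎ x ∈ C)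
    uncovered sA sB sC = no-cover _ _ _ sA sB sC ∘ covers⇒∪≡⊤

    Small-⊆ : A ⊆ B → Small 𝒮 B → f A ≤ k → Small 𝒮 A
    Small-⊆ {A = A} A⊆B sB fA≤k with small-or-big fA≤k
    ... | inj₁ sA = sA
    ... | inj₂ bA = ⊥-elim (uncovered sB bA bA λ x → [ inj₁ ∘ A⊆B , inj₂ ∘ inj₁ ]′ (∈-or-∈∁ x A))

    Big-⊇ : A ⊆ B → Big 𝒮 A → f B ≤ k → Big 𝒮 B
    Big-⊇ A⊆B bA fB≤k with small-or-big fB≤k
    ... | inj₂ bB = bB
    ... | inj₁ sB = ⊥-elim (small∧big⇒⊥ (Small-⊆ A⊆B sB (Big⇒≤ bA)) bA)

    Big-∩ : Big 𝒮 X → Big 𝒮 Y → f (X ∩ Y) ≤ k → Big 𝒮 (X ∩ Y)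
    Big-∩ {X = X} {Y} bX bY fX∩Y≤k with small-or-big fX∩Y≤k
    ... | inj₂ bX∩Y = bX∩Y
    ... | inj₁ sX∩Y = ⊥-elim (uncovered sX∩Y bX bY cover)
      where
      cover : ∀ x → x ∈ X ∩ Y ⊎ x ∈ ∁ X ⊎ x ∈ ∁ Y
      cover x with ∈-or-∈∁ x X | ∈-or-∈∁ x Y
      ... | inj₁ x∈X | inj₁ x∈Y = inj₁ (x∈p∩q⁺ (x∈X , x∈Y))
      ... | inj₂ x∉X | _        = inj₂ (inj₁ x∉X)
      ... | inj₁ _   | inj₂ x∉Y = inj₂ (inj₂ x∉Y)

  distinguishes-swap : Distinguishes A 𝒫 𝒬 → Distinguishes A 𝒬 𝒫
  distinguishes-swap (inj₁ (sP , sQ)) = inj₂ (sQ , sP)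
  distinguishes-swap (inj₂ (sP , sQ)) = inj₁ (sQ , sP)

  distinguishes-∁ : ∀ {𝒫 𝒬} → Distinguishes A 𝒫 𝒬 → Distinguishes (∁ A) 𝒫 𝒬
  distinguishes-∁ {𝒫 = 𝒫} {𝒬} (inj₁ (sP , bQ)) = inj₂ (Small⇒Big∁ 𝒫 sP , bQ)
  distinguishes-∁ {𝒫 = 𝒫} {𝒬} (inj₂ (bP , sQ)) = inj₁ (bP , Small⇒Big∁ 𝒬 sQ)

  distinguishes? : (A : Subset n) (𝒫 𝒬 : Collection n) → Dec (Distinguishes A 𝒫 𝒬)
  distinguishes? A 𝒫 𝒬 = (small? 𝒫 A ×-dec small? 𝒬 (∁ A)) ⊎-dec (small? 𝒫 (∁ A) ×-dec small? 𝒬 A)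

  efficiently-∁ : ∀ {f : Subset n → ℤ} → Symmetric f →
    DistinguishesEfficiently f A 𝒫 𝒬 → DistinguishesEfficiently f (∁ A) 𝒫 𝒬
  efficiently-∁ {A = A} {𝒫} {𝒬} {f} symmetric (dA , min) =
    distinguishes-∁ {A = A} {𝒫} {𝒬} dA , λ B → subst (_≤ f B) (symmetric A) ∘ min B

  -- If Y is big in both 𝒫 and 𝒬 and distinguishes two other tangles efficiently, then a corner
  -- of X and Y distinguishes 𝒫 from 𝒬 at most as expensively as X: otherwise both corners X ∪ Y and
  -- ∁ X ∪ Y would be cheaper than Y, hence big in 𝒬′, and with Y they would cover E.
  module _ {f : Subset n → ℤ} (symmetric : Symmetric f) (submodular : Submodular f)
           {kP kQ kP′ kQ′ : ℤ} {𝒫′ 𝒬′ : Collection n}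
           (TP : IsTangle f kP 𝒫) (TQ : IsTangle f kQ 𝒬) (TP′ : IsTangle f kP′ 𝒫′) (TQ′ : IsTangle f kQ′ 𝒬′) where
    private
      module P  = Tangle symmetric TP
      module Q  = Tangle symmetric TQ
      module P′ = Tangle symmetric TP′
      module Q′ = Tangle symmetric TQ′

    uncross-oriented : Big 𝒫 X → Small 𝒬 X → Big 𝒫 Y → Big 𝒬 Y → Big 𝒫′ Y → Small 𝒬′ Y →
      (∀ B → Distinguishes B 𝒫′ 𝒬′ → f Y ≤ f B) →
      ∃ λ Z → Corner X Y Z × Distinguishes Z 𝒫 𝒬 × f Z ≤ f X
    uncross-oriented {X = X} {Y} bPX sQX bPY bQY bP′Y sQ′Y Y-efficient with f Y ≤? f (X ∪ Y) | f Y ≤? f (∁ X ∪ Y)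
    ... | yes fY≤ | _ = X ∩ Y , inj₁ refl , inj₂ (bP , sQ) , f∩≤
      where
      f∩≤ = submodular-∩ f submodular X Y fY≤
      bP  = P.Big-∩ bPX bPY (≤-trans f∩≤ (P.Big⇒≤ bPX))
      sQ  = Q.Small-⊆ (p∩q⊆p X Y) sQX (≤-trans f∩≤ (Q.Small⇒≤ sQX))
    ... | no _ | yes fY≤ = ∁ X ∩ Y , inj₂ refl , inj₁ (sP , bQ) , f∩≤
      where
      f∩≤ = subst (f (∁ X ∩ Y) ≤_) (sym (symmetric X)) (submodular-∩ f submodular (∁ X) Y fY≤)
      bQ  = Q.Big-∩ (Small⇒Big∁ 𝒬 sQX) bQY (≤-trans f∩≤ (Q.Small⇒≤ sQX))
      sP  = P.Small-⊆ (p∩q⊆p (∁ X) Y) bPX (≤-trans f∩≤ (P.Big⇒≤ bPX))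
    ... | no fY≰ | no fY≰′ = ⊥-elim (Q′.uncovered (big-in-𝒬′ X fY≰) (big-in-𝒬′ (∁ X) fY≰′) sQ′Y cover)
      where
      -- A small side W ∪ Y in 𝒬′ would distinguish 𝒫′ and 𝒬′ with order below f Y.
      big-in-𝒬′ : ∀ W → ¬ f Y ≤ f (W ∪ Y) → Big 𝒬′ (W ∪ Y)
      big-in-𝒬′ W fY≰ with Q′.small-or-big (≤-trans (<⇒≤ (≰⇒> fY≰)) (Q′.Small⇒≤ sQ′Y))
      ... | inj₂ big   = big
      ... | inj₁ small = ⊥-elim (fY≰ (Y-efficient (W ∪ Y) (inj₂ (bP′ , small))))
        where bP′ = P′.Big-⊇ (q⊆p∪q W Y) bP′Y (≤-trans (<⇒≤ (≰⇒> fY≰)) (P′.Big⇒≤ bP′Y))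
      cover : ∀ x → x ∈ ∁ (X ∪ Y) ⊎ x ∈ ∁ (∁ X ∪ Y) ⊎ x ∈ Y
      cover x with ∈-or-∈∁ x Y | ∈-or-∈∁ x X
      ... | inj₁ x∈Y | _        = inj₂ (inj₂ x∈Y)
      ... | inj₂ x∉Y | inj₁ x∈X =
        inj₂ (inj₁ (x∉p⇒x∈∁p ([ x∈p⇒x∉∁p x∈X , x∈∁p⇒x∉p x∉Y ]′ ∘ x∈p∪q⁻ (∁ X) Y)))
      ... | inj₂ x∉Y | inj₂ x∉X = inj₁ (x∉p⇒x∈∁p ([ x∈∁p⇒x∉p x∉X , x∈∁p⇒x∉p x∉Y ]′ ∘ x∈p∪q⁻ X Y))

  module _ {f : Subset n → ℤ} (symmetric : Symmetric f) (submodular : Submodular f)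
           {kP′ kQ′ : ℤ} {𝒫′ 𝒬′ : Collection n} (TP′ : IsTangle f kP′ 𝒫′) (TQ′ : IsTangle f kQ′ 𝒬′) where

    private
      uncross-with : ∀ {kP kQ} → IsTangle f kP 𝒫 → IsTangle f kQ 𝒬 → Big 𝒫 X → Small 𝒬 X → Big 𝒫 Y → Big 𝒬 Y →
        DistinguishesEfficiently f Y 𝒫′ 𝒬′ → ∃ λ Z → Corner X Y Z × Distinguishes Z 𝒫 𝒬 × f Z ≤ f X
      uncross-with TP TQ bPX sQX bPY bQY (inj₂ (bP′Y , sQ′Y) , Y-min) =
        uncross-oriented symmetric submodular TP TQ TP′ TQ′ bPX sQX bPY bQY bP′Y sQ′Y Y-min
      uncross-with TP TQ bPX sQX bPY bQY (inj₁ (sP′Y , bQ′Y) , Y-min) =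
        uncross-oriented symmetric submodular TP TQ TQ′ TP′ bPX sQX bPY bQY bQ′Y sP′Y
          (λ B → Y-min B ∘ distinguishes-swap {A = B} {𝒬′} {𝒫′})

    uncross : ∀ {kP kQ} → IsTangle f kP 𝒫 → IsTangle f kQ 𝒬 → Distinguishes X 𝒫 𝒬 → Big 𝒫 Y → Big 𝒬 Y →
      DistinguishesEfficiently f Y 𝒫′ 𝒬′ → ∃ λ Z → Corner X Y Z × Distinguishes Z 𝒫 𝒬 × f Z ≤ f X
    uncross TP TQ (inj₂ (bPX , sQX)) bPY bQY Y-eff = uncross-with TP TQ bPX sQX bPY bQY Y-eff
    uncross {𝒫 = 𝒫} {𝒬} TP TQ (inj₁ (sPX , bQX)) bPY bQY Y-eff
      with Z , corner , dZ , fZ≤ ← uncross-with TQ TP bQX sPX bQY bPY Y-eff =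
      Z , corner , distinguishes-swap {A = Z} {𝒬} {𝒫} dZ , fZ≤

module MaximalTangles where

  open import Data.Nat as ℕ using (ℕ)
  import Data.Nat.Properties as ℕ
  open import Data.Integer using (ℤ; _≤_; _≤?_; pred)
  open import Data.Integer.Properties using (≤-trans; ≤-total; ≤⇒≯; i≤pred[j]⇒i<j)
  open import Data.Bool using (Bool; false)
  import Data.Bool.Properties as Bool
  open import Data.Fin.Properties using (all?)
  open import Data.Fin.Subset using (Subset; ∁; _∪_; ⊤; ⁅_⁆)
  open import Data.Fin.Subset.Properties using (anySubset?)
  open import Data.Vec.Properties using (≡-dec)
  open import Data.List using (List; []; _∷_)
  open import Data.List.Membership.Propositional using (_∈_)
  open import Data.List.Relation.Unary.Any using (here; there)
  open import Data.Product as Product using (Σ; ∃; _×_; _,_; proj₁; proj₂; map₁; map₂; swap)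
  open import Data.Sum using (_⊎_; inj₁; inj₂)
  import Data.Sum as Sum
  open import Data.Empty using (⊥-elim)
  open import Data.Unit using (tt) renaming (⊤ to Unit)
  open import Function using (_∘_; id; mk⇔)
  open import Relation.Nullary using (¬_; Dec; yes; no)
  open import Relation.Nullary.Decidable using (map′; decidable-stable; _×-dec_; _⊎-dec_; _→-dec_; ¬?)
  open import Relation.Binary.PropositionalEquality using (_≡_; _≗_; refl; sym; trans)
  open import Defs
  open FiniteSearch
  open Tangles

  module Enumeration {n : ℕ} (f : Subset n → ℤ) where

    private variable
      k : ℤ
      A : Subset n
      𝒫 𝒫′ 𝒬 𝒬′ 𝒮 𝒮′ : Collection n

    Small-≗ : 𝒮 ≗ 𝒮′ → Small 𝒮 A → Small 𝒮′ A
    Small-≗ {A = A} 𝒮≗𝒮′ = trans (sym (𝒮≗𝒮′ A))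

    IsTangle-≗ : 𝒮 ≗ 𝒮′ → IsTangle f k 𝒮 → IsTangle f k 𝒮′
    IsTangle-≗ {𝒮 = 𝒮} {𝒮′} 𝒮≗𝒮′ T = record
      { small-order  = λ A → small-order A ∘ back
      ; orient       = λ A → Sum.map (Small-≗ 𝒮≗𝒮′) (Small-≗ 𝒮≗𝒮′) ∘ orient A
      ; exclusive    = λ A (s , s∁) → exclusive A (back s , back s∁)
      ; no-cover     = λ A B C sA sB sC → no-cover A B C (back sA) (back sB) (back sC)
      ; co-singleton = λ e → co-singleton e ∘ back
      }
      where
      open IsTangle T
      back : ∀ {A} → Small 𝒮′ A → Small 𝒮 A
      back = Small-≗ (sym ∘ 𝒮≗𝒮′)

    ⊂ᶜ-respˡ-≗ : 𝒮 ≗ 𝒮′ → 𝒮′ ⊂ᶜ 𝒫 → 𝒮 ⊂ᶜ 𝒫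
    ⊂ᶜ-respˡ-≗ 𝒮≗𝒮′ (⊆ , A , s , ¬s) = (λ B → ⊆ B ∘ Small-≗ 𝒮≗𝒮′) , A , s , ¬s ∘ Small-≗ 𝒮≗𝒮′

    ⊂ᶜ-respʳ-≗ : 𝒮 ≗ 𝒮′ → 𝒫 ⊂ᶜ 𝒮 → 𝒫 ⊂ᶜ 𝒮′
    ⊂ᶜ-respʳ-≗ 𝒮≗𝒮′ (⊆ , A , s , ¬s) = (λ B → Small-≗ 𝒮≗𝒮′ ∘ ⊆ B) , A , Small-≗ 𝒮≗𝒮′ s , ¬s

    IsMaximalTangle-≗ : 𝒮 ≗ 𝒮′ → IsMaximalTangle f 𝒮 → IsMaximalTangle f 𝒮′
    IsMaximalTangle-≗ 𝒮≗𝒮′ ((k , T) , maximal) =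
      (k , IsTangle-≗ 𝒮≗𝒮′ T) , λ 𝒫 T𝒫 → maximal 𝒫 T𝒫 ∘ ⊂ᶜ-respˡ-≗ 𝒮≗𝒮′

    Distinguishes-≗ : 𝒫 ≗ 𝒫′ → 𝒬 ≗ 𝒬′ → Distinguishes A 𝒫 𝒬 → Distinguishes A 𝒫′ 𝒬′
    Distinguishes-≗ 𝒫≗ 𝒬≗ = Sum.map (Product.map (Small-≗ 𝒫≗) (Small-≗ 𝒬≗)) (Product.map (Small-≗ 𝒫≗) (Small-≗ 𝒬≗))

    isTangle? : ∀ k (𝒮 : Collection n) → Dec (IsTangle f k 𝒮)
    isTangle? k 𝒮
      with ∀-Subset? (λ A → small? 𝒮 A →-dec f A ≤? k)
         | ∀-Subset? (λ A → f A ≤? k →-dec (small? 𝒮 A ⊎-dec small? 𝒮 (∁ A)))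
         | ∀-Subset? (λ A → ¬? (small? 𝒮 A ×-dec small? 𝒮 (∁ A)))
         | ∀-Subset? (λ A → ∀-Subset? λ B → ∀-Subset? λ C →
             small? 𝒮 A →-dec small? 𝒮 B →-dec small? 𝒮 C →-dec ¬? (≡-dec Bool._≟_ ((A ∪ B) ∪ C) ⊤))
         | all? (λ e → ¬? (small? 𝒮 (∁ ⁅ e ⁆)))
    ... | yes h₁ | yes h₂ | yes h₃ | yes h₄ | yes h₅ =
      yes record { small-order = h₁ ; orient = h₂ ; exclusive = h₃ ; no-cover = h₄ ; co-singleton = h₅ }
    ... | no ¬h | _ | _ | _ | _ = no (¬h ∘ IsTangle.small-order)
    ... | _ | no ¬h | _ | _ | _ = no (¬h ∘ IsTangle.orient)
    ... | _ | _ | no ¬h | _ | _ = no (¬h ∘ IsTangle.exclusive)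
    ... | _ | _ | _ | no ¬h | _ = no (¬h ∘ IsTangle.no-cover)
    ... | _ | _ | _ | _ | no ¬h = no (¬h ∘ IsTangle.co-singleton)

    IsTangle-atOrder : ∀ {k′} → IsTangle f k 𝒮 → (∀ A → Small 𝒮 A → f A ≤ k′) →
      (∀ A → f A ≤ k′ → Small 𝒮 A ⊎ Small 𝒮 (∁ A)) → IsTangle f k′ 𝒮
    IsTangle-atOrder T small-order orient = record
      { small-order = small-order ; orient = orient
      ; exclusive = IsTangle.exclusive T ; no-cover = IsTangle.no-cover T ; co-singleton = IsTangle.co-singleton T }

    private
      module ByOrder   = Minimum (λ A B → f A ≤ f B) (λ A B → ≤-total (f A) (f B)) ≤-trans
      module ByOrderᵒᵖ = Minimum (λ A B → f B ≤ f A) (λ A B → ≤-total (f B) (f A)) (λ B≤A C≤B → ≤-trans C≤B B≤A)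

    minimum-order : ∃ λ X → ∀ B → f X ≤ f B
    minimum-order with ByOrder.minimal {P = λ _ → Unit} (λ _ → yes tt) (subsets n) (∈-subsets ⊤) tt
    ... | X , _ , _ , X-min = X , λ B → X-min (∈-subsets B) tt

    -- No separation has order at most k₀, so every collection with no small side is a tangle of order k₀ + 1.
    k₀ : ℤ
    k₀ = pred (f (proj₁ minimum-order))

    k₀<f : ∀ A → ¬ f A ≤ k₀
    k₀<f A fA≤k₀ = ≤⇒≯ (proj₂ minimum-order A) (i≤pred[j]⇒i<j fA≤k₀)

    isTangleAny? : (𝒮 : Collection n) → Dec (IsTangleAny f 𝒮)
    isTangleAny? 𝒮 with anySubset? (small? 𝒮)
    ... | no none with isTangle? k₀ 𝒮
    ...   | yes T = yes (k₀ , T)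
    ...   | no ¬T = no λ (_ , T) → ¬T (IsTangle-atOrder T (λ A sA → ⊥-elim (none (A , sA))) (λ A → ⊥-elim ∘ k₀<f A))
    isTangleAny? 𝒮 | yes (A , sA) with ByOrderᵒᵖ.minimal (small? 𝒮) (subsets n) (∈-subsets A) sA
    ... | X , _ , sX , X-max with isTangle? (f X) 𝒮
    ...   | yes T = yes (f X , T)
    ...   | no ¬T = no λ (_ , T) → ¬T (IsTangle-atOrder T (λ B → X-max (∈-subsets B))
                                      (λ B fB≤fX → IsTangle.orient T B (≤-trans fB≤fX (IsTangle.small-order T X sX))))

    ⊂ᶜ? : (𝒮 𝒮′ : Collection n) → Dec (𝒮 ⊂ᶜ 𝒮′)
    ⊂ᶜ? 𝒮 𝒮′ = ∀-Subset? (λ A → small? 𝒮 A →-dec small? 𝒮′ A)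
         ×-dec anySubset? (λ A → small? 𝒮′ A ×-dec ¬? (small? 𝒮 A))

    isMaximalTangle? : (𝒮 : Collection n) → Dec (IsMaximalTangle f 𝒮)
    isMaximalTangle? 𝒮 = isTangleAny? 𝒮 ×-dec map′ maximal (λ h _ → h _)
      (∀-∈? (λ ψ → isTangleAny? ψ →-dec ¬? (⊂ᶜ? 𝒮 ψ)) (predicates n))
      where
      maximal : (∀ {ψ} → ψ ∈ predicates n → IsTangleAny f ψ → ¬ 𝒮 ⊂ᶜ ψ) →
        ∀ 𝒮′ → IsTangleAny f 𝒮′ → ¬ 𝒮 ⊂ᶜ 𝒮′
      maximal h 𝒮′ T 𝒮⊂𝒮′ with predicates-complete 𝒮′
      ... | ψ , ψ∈ , 𝒮′≗ψ = h ψ∈ (map₂ (IsTangle-≗ 𝒮′≗ψ) T) (⊂ᶜ-respʳ-≗ 𝒮′≗ψ 𝒮⊂𝒮′)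

    MaximalTangle : Set
    MaximalTangle = Σ (Collection n) (IsMaximalTangle f)

    coll : MaximalTangle → Collection n
    coll = proj₁

    order : MaximalTangle → ℤ
    order 𝒫 = proj₁ (proj₁ (proj₂ 𝒫))

    tangle : (𝒫 : MaximalTangle) → IsTangle f (order 𝒫) (coll 𝒫)
    tangle 𝒫 = proj₂ (proj₁ (proj₂ 𝒫))

    maximalAmong : List (Collection n) → List MaximalTangle
    maximalAmong []       = []
    maximalAmong (ψ ∷ ψs) with isMaximalTangle? ψ
    ... | yes max = (ψ , max) ∷ maximalAmong ψs
    ... | no  _   = maximalAmong ψs

    ∈-maximalAmong : ∀ {ψ} ψs → ψ ∈ ψs → IsMaximalTangle f ψ → ∃ λ 𝒫 → 𝒫 ∈ maximalAmong ψs × coll 𝒫 ≡ ψ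
    ∈-maximalAmong (ψ ∷ ψs) ψ∈ max with isMaximalTangle? ψ | ψ∈
    ... | yes max′ | here refl = _ , here refl , refl
    ... | no ¬max  | here refl = ⊥-elim (¬max max)
    ... | yes _    | there ψ∈ψs = map₂ (map₁ there) (∈-maximalAmong ψs ψ∈ψs max)
    ... | no _     | there ψ∈ψs = ∈-maximalAmong ψs ψ∈ψs max

    maximalTangles : List MaximalTangle
    maximalTangles = maximalAmong (predicates n)

    ∈-maximalTangles : IsMaximalTangle f 𝒮 → ∃ λ 𝒫 → 𝒫 ∈ maximalTangles × 𝒮 ≗ coll 𝒫
    ∈-maximalTangles {𝒮} max with predicates-complete 𝒮
    ... | ψ , ψ∈ , 𝒮≗ψ with ∈-maximalAmong (predicates n) ψ∈ (IsMaximalTangle-≗ 𝒮≗ψ max)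
    ...   | 𝒫 , 𝒫∈ , refl = 𝒫 , 𝒫∈ , 𝒮≗ψ

    trivialTangle : IsTangle f k₀ (λ _ → false)
    trivialTangle = record
      { small-order = λ _ () ; orient = λ A → ⊥-elim ∘ k₀<f A
      ; exclusive = λ _ () ; no-cover = λ _ _ _ () ; co-singleton = λ _ () }

    smallCount : Collection n → ℕ
    smallCount 𝒮 = count (small? 𝒮) (subsets n)

    ⊂ᶜ⇒smallCount< : 𝒮 ⊂ᶜ 𝒮′ → smallCount 𝒮 ℕ.< smallCount 𝒮′
    ⊂ᶜ⇒smallCount< {𝒮} {𝒮′} (𝒮⊆𝒮′ , A , s′ , ¬s) =
      count-mono-< (small? 𝒮) (small? 𝒮′) (subsets n) (λ {B} _ → 𝒮⊆𝒮′ B) (∈-subsets A) ¬s s′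

    -- A tangle with the most small sides is maximal; the trivial tangle shows that tangles exist.
    maximalTangle-exists : ∃ (_∈ maximalTangles)
    maximalTangle-exists with predicates-complete (λ _ → false)
    ... | ψ₀ , ψ₀∈ , ≗ψ₀ with MostSmall.minimal isTangleAny? (predicates n) ψ₀∈ (k₀ , IsTangle-≗ ≗ψ₀ trivialTangle)
      where module MostSmall = Minimum (λ 𝒮 𝒮′ → smallCount 𝒮′ ℕ.≤ smallCount 𝒮)
                                       (λ 𝒮 𝒮′ → ℕ.≤-total (smallCount 𝒮′) (smallCount 𝒮))
                                       (λ 𝒮′≤𝒮 𝒮″≤𝒮′ → ℕ.≤-trans 𝒮″≤𝒮′ 𝒮′≤𝒮)
    ... | 𝒮 , _ , T , most = _ , proj₁ (proj₂ (∈-maximalTangles (T , maximal)))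
      where
      maximal : ∀ 𝒮′ → IsTangleAny f 𝒮′ → ¬ 𝒮 ⊂ᶜ 𝒮′
      maximal 𝒮′ T′ 𝒮⊂𝒮′ with predicates-complete 𝒮′
      ... | ψ , ψ∈ , 𝒮′≗ψ = ℕ.<⇒≱ (⊂ᶜ⇒smallCount< (⊂ᶜ-respʳ-≗ 𝒮′≗ψ 𝒮⊂𝒮′)) (most ψ∈ (map₂ (IsTangle-≗ 𝒮′≗ψ) T′))

    ¬⊈⇒⊆ᶜ : ¬ (∃ λ A → Small 𝒮 A × ¬ Small 𝒮′ A) → 𝒮 ⊆ᶜ 𝒮′
    ¬⊈⇒⊆ᶜ {𝒮′ = 𝒮′} ⊈ A s = decidable-stable (small? 𝒮′ A) (⊈ ∘ (A ,_) ∘ (s ,_))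

    -- Otherwise every small side of 𝒫 is small in 𝒬, and maximality of 𝒫 forces 𝒫 ≗ 𝒬.
    maximal-differs : ∀ {kP kQ} → IsTangle f kP 𝒫 → (∀ 𝒮′ → IsTangleAny f 𝒮′ → ¬ 𝒫 ⊂ᶜ 𝒮′) → IsTangle f kQ 𝒬 →
      kP ≤ kQ → ¬ 𝒫 ≗ 𝒬 → ∃ λ A → Small 𝒫 A × Big 𝒬 A
    maximal-differs {𝒫} {𝒬} {kQ = kQ} TP maximal TQ kP≤kQ 𝒫≉𝒬 with anySubset? (λ A → small? 𝒫 A ×-dec ¬? (small? 𝒬 A))
    ... | yes (A , sP , ¬sQ) =
      A , sP , Sum.[ ⊥-elim ∘ ¬sQ , id ]′ (IsTangle.orient TQ A (≤-trans (IsTangle.small-order TP A sP) kP≤kQ))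
    ... | no 𝒫⊈𝒬 with anySubset? (λ A → small? 𝒬 A ×-dec ¬? (small? 𝒫 A))
    ...   | yes (A , sQ , ¬sP) = ⊥-elim (maximal 𝒬 (kQ , TQ) (¬⊈⇒⊆ᶜ 𝒫⊈𝒬 , A , sQ , ¬sP))
    ...   | no 𝒬⊈𝒫 = ⊥-elim (𝒫≉𝒬 λ A → Bool.⇔→≡ (mk⇔ (¬⊈⇒⊆ᶜ 𝒫⊈𝒬 A) (¬⊈⇒⊆ᶜ 𝒬⊈𝒫 A)))

    distinguishable : IsMaximalTangle f 𝒫 → IsMaximalTangle f 𝒬 → ¬ 𝒫 ≗ 𝒬 → ∃ λ A → Distinguishes A 𝒫 𝒬
    distinguishable ((kP , TP) , maxP) ((kQ , TQ) , maxQ) 𝒫≉𝒬 with ≤-total kP kQ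
    ... | inj₁ kP≤kQ = map₂ inj₁ (maximal-differs TP maxP TQ kP≤kQ 𝒫≉𝒬)
    ... | inj₂ kQ≤kP = map₂ (inj₂ ∘ swap) (maximal-differs TQ maxQ TP kQ≤kP (𝒫≉𝒬 ∘ (sym ∘_)))

module Trees where

  open import Data.Nat as ℕ using (ℕ; zero; suc; z≤n; s≤s)
  import Data.Nat.Properties as ℕ
  open import Data.Bool using (true)
  open import Data.Bool.Properties using (T-≡)
  open import Data.Fin using (Fin; zero; suc; toℕ; _<_; _≤_; _≟_)
  open import Data.Fin.Properties using (toℕ<n)
  open import Data.Fin.Induction using (<-wellFounded)
  open import Data.Fin.Subset using (Subset; _∈_; _∉_; _⊆_; _⊂_; ⊤)
  open import Data.Fin.Subset.Properties using (_∈?_; _⊂?_; ∈⊤; ⊆-antisym)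
  open import Data.Vec.Properties using ([]=⇒lookup; lookup⇒[]=; lookup∘tabulate)
  open import Data.List using (allFin; upTo)
  open import Data.List.Membership.Propositional using (lose)
  open import Data.List.Membership.Propositional.Properties using (∈-upTo⁺; ∈-allFin)
  open import Data.List.Relation.Unary.Any using (satisfied)
  open import Data.List.Relation.Unary.Any.Properties using (any⁺; any⁻)
  open import Data.Product using (∃; _×_; _,_; proj₁)
  open import Data.Sum using (_⊎_; inj₁; inj₂)
  import Data.Sum as Sum
  open import Data.Empty using (⊥-elim)
  open import Function using (_∘_; id; Equivalence)
  open import Induction.WellFounded using (Acc; acc)
  open import Relation.Nullary using (¬_; yes; no; does)
  open import Relation.Nullary.Decidable using (dec-true)
  open import Relation.Unary using (Decidable)
  open import Relation.Binary.PropositionalEquality using (_≡_; _≢_; refl; sym; trans; cong; subst)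
  open import Defs using (TreeDecomposition)
  open Separations using (⊆∧≢⇒⊂)
  open FiniteSearch using (module Minimum)

  -- A laminar family, listed so that strict supersets come first, is the family of
  -- separations S(X_{suc i}) of a tree: vertex suc i stands for M i, zero for the whole ground set.
  module LaminarTree {n m : ℕ} (M : Fin m → Subset n)
    (laminar : ∀ i j → M i ⊆ M j ⊎ M j ⊆ M i ⊎ (∀ {x} → x ∈ M i → x ∉ M j))
    (M-injective : ∀ {i j} → M i ≡ M j → i ≡ j)
    (⊂⇒> : ∀ {i j} → M i ⊂ M j → j < i)
    where

    private variable
      x : Fin n
      i j : Fin m

    ⊆⇒⊂ : M i ⊆ M j → i ≢ j → M i ⊂ M j
    ⊆⇒⊂ Mi⊆Mj i≢j = ⊆∧≢⇒⊂ Mi⊆Mj (i≢j ∘ M-injective)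

    shared-point⇒⊆ : x ∈ M i → x ∈ M j → i ≤ j → M j ⊆ M i
    shared-point⇒⊆ {i = i} {j} x∈Mi x∈Mj i≤j with laminar i j
    ... | inj₂ (inj₁ Mj⊆Mi)  = Mj⊆Mi
    ... | inj₂ (inj₂ apart)  = ⊥-elim (apart x∈Mi x∈Mj)
    ... | inj₁ Mi⊆Mj with i ≟ j
    ...   | yes refl = id
    ...   | no  i≢j  = ⊥-elim (ℕ.<⇒≱ (⊂⇒> (⊆⇒⊂ Mi⊆Mj i≢j)) i≤j)

    Last : (Fin m → Set) → Set
    Last P = (∀ j → ¬ P j) ⊎ ∃ λ j → P j × (∀ {j′} → P j′ → j′ ≤ j)

    last : {P : Fin m → Set} → Decidable P → Last P
    last P? = Sum.map (λ none j → none (∈-allFin j)) (λ (j , _ , pj , max) → j , pj , max (∈-allFin _))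
                      (Latest.minimal? P? (allFin m))
      where module Latest = Minimum (λ i j → j ≤ i) (λ i j → ℕ.≤-total (toℕ j) (toℕ i)) (λ j≤i k≤j → ℕ.≤-trans k≤j j≤i)

    vertex : {P : Fin m → Set} → Last P → Fin (suc m)
    vertex (inj₁ _)       = zero
    vertex (inj₂ (j , _)) = suc j

    -- The parent of M i is its last, hence smallest, strict superset; x lies in the part of the last set containing it.
    parentSearch : (i : Fin m) → Last (λ j → M i ⊂ M j)
    parentSearch i = last (λ j → M i ⊂? M j)

    partSearch : (x : Fin n) → Last (λ j → x ∈ M j)
    partSearch x = last (λ j → x ∈? M j)

    parent≤ : (i : Fin m) → toℕ (vertex (parentSearch i)) ℕ.≤ toℕ i
    parent≤ i with parentSearch i
    ... | inj₁ _              = z≤n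
    ... | inj₂ (_ , Mi⊂Mj , _) = ⊂⇒> Mi⊂Mj

    tree : TreeDecomposition n
    tree = record { m = m ; par = vertex ∘ parentSearch ; par< = parent≤ ; part = vertex ∘ partSearch }

    open TreeDecomposition tree using (par; part; parentF; iter; isAnc; below)

    region : Fin (suc m) → Subset n
    region zero    = ⊤
    region (suc j) = M j

    ∈-region-part : ∀ x → x ∈ region (part x)
    ∈-region-part x with partSearch x
    ... | inj₁ _              = ∈⊤
    ... | inj₂ (_ , x∈Mj , _) = x∈Mj

    region-parentF : ∀ v → region v ⊆ region (parentF v)
    region-parentF zero    = id
    region-parentF (suc i) with parentSearch i
    ... | inj₁ _               = λ _ → ∈⊤
    ... | inj₂ (_ , Mi⊂Mj , _) = proj₁ Mi⊂Mj

    ∈-region-iter : ∀ x k → x ∈ region (iter k (part x))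
    ∈-region-iter x zero    = ∈-region-part x
    ∈-region-iter x (suc k) = region-parentF (iter k (part x)) (∈-region-iter x k)

    iter-suc : ∀ k v → iter (suc k) v ≡ iter k (parentF v)
    iter-suc zero    v = refl
    iter-suc (suc k) v = cong parentF (iter-suc k v)

    isAnc⇒ : ∀ {u v} → isAnc u v ≡ true → ∃ λ k → iter k v ≡ u
    isAnc⇒ {u} {v} anc
      with k , k-hit ← satisfied (any⁻ (λ k → does (iter k v ≟ u)) (upTo (suc m)) (Equivalence.from T-≡ anc))
      with iter k v ≟ u | k-hit
    ... | yes iter≡ | _ = k , iter≡
    ... | no  _     | ()

    isAnc⇐ : ∀ {u v} k → k ℕ.≤ m → iter k v ≡ u → isAnc u v ≡ true
    isAnc⇐ {u} {v} k k≤m k-hit = Equivalence.to T-≡ (any⁺ {xs = upTo (suc m)} (λ k → does (iter k v ≟ u))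
      (lose (∈-upTo⁺ (s≤s k≤m)) (Equivalence.from T-≡ (dec-true (iter k v ≟ u) k-hit))))

    isAnc⇒∈below : isAnc (suc i) (part x) ≡ true → x ∈ below i
    isAnc⇒∈below {i} {x} anc = lookup⇒[]= x _ (trans (lookup∘tabulate _ x) anc)

    ∈below⇒isAnc : x ∈ below i → isAnc (suc i) (part x) ≡ true
    ∈below⇒isAnc {x} {i} x∈below = trans (sym (lookup∘tabulate _ x)) ([]=⇒lookup x∈below)

    parent-above : M j ⊂ M i → ∃ λ j′ → par j ≡ suc j′ × i ≤ j′ × M j ⊂ M j′ × j′ < j
    parent-above {j} {i} Mj⊂Mi with parentSearch j
    ... | inj₁ none              = ⊥-elim (none i Mj⊂Mi)
    ... | inj₂ (j′ , Mj⊂Mj′ , max) = j′ , refl , max Mj⊂Mi , Mj⊂Mj′ , ⊂⇒> Mj⊂Mj′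

    climb : ∀ i j → Acc _<_ j → x ∈ M i → x ∈ M j → i ≤ j → ∃ λ k → k ℕ.≤ toℕ j × iter k (suc j) ≡ suc i
    climb i j _ x∈Mi x∈Mj i≤j with j ≟ i
    ... | yes refl = 0 , z≤n , refl
    climb i j (acc rec) x∈Mi x∈Mj i≤j | no j≢i with parent-above (⊆⇒⊂ (shared-point⇒⊆ x∈Mi x∈Mj i≤j) j≢i)
    ... | j′ , par≡ , i≤j′ , Mj⊂Mj′ , j′<j with climb i j′ (rec j′<j) x∈Mi (proj₁ Mj⊂Mj′ x∈Mj) i≤j′
    ...   | k , k≤j′ , k-hit = suc k , ℕ.≤-<-trans k≤j′ j′<j , trans (iter-suc k (suc j)) (trans (cong (iter k) par≡) k-hit)

    part-below : x ∈ M i → ∃ λ j → part x ≡ suc j × i ≤ j × x ∈ M j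
    part-below {x} x∈Mi with partSearch x
    ... | inj₁ none             = ⊥-elim (none _ x∈Mi)
    ... | inj₂ (j , x∈Mj , max) = j , refl , max x∈Mi , x∈Mj

    ∈M⇒∈below : x ∈ M i → x ∈ below i
    ∈M⇒∈below {i = i} x∈Mi with j , part≡ , i≤j , x∈Mj ← part-below x∈Mi
      with k , k≤j , k-hit ← climb i j (<-wellFounded j) x∈Mi x∈Mj i≤j
      = isAnc⇒∈below (isAnc⇐ k (ℕ.≤-trans k≤j (ℕ.<⇒≤ (toℕ<n j))) (trans (cong (iter k) part≡) k-hit))

    ∈below⇒∈M : x ∈ below i → x ∈ M i
    ∈below⇒∈M {x} x∈below with k , k-hit ← isAnc⇒ (∈below⇒isAnc x∈below) =
      subst (λ v → x ∈ region v) k-hit (∈-region-iter x k)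

    below≡M : ∀ i → below i ≡ M i
    below≡M i = ⊆-antisym ∈below⇒∈M ∈M⇒∈below

    parent-zero : ∀ i → par i ≡ zero → ∀ l → ¬ M i ⊂ M l
    parent-zero i = from (parentSearch i)
      where
      from : (r : Last (λ j → M i ⊂ M j)) → vertex r ≡ zero → ∀ l → ¬ M i ⊂ M l
      from (inj₁ none) _ = none
      from (inj₂ _)   ()

    parent-suc : ∀ i j → par i ≡ suc j → M i ⊂ M j × (∀ l → ¬ (M i ⊂ M l × M l ⊂ M j))
    parent-suc i j = from (parentSearch i)
      where
      from : (r : Last (λ j → M i ⊂ M j)) → vertex r ≡ suc j → M i ⊂ M j × (∀ l → ¬ (M i ⊂ M l × M l ⊂ M j))
      from (inj₁ _) ()
      from (inj₂ (_ , Mi⊂Mj , max)) refl = Mi⊂Mj , λ l (Mi⊂Ml , Ml⊂Mj) → ℕ.<⇒≱ (⊂⇒> Ml⊂Mj) (max Mi⊂Ml)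

module TreeOfTangles where

  open import Data.Nat as ℕ using (ℕ; zero; suc)
  import Data.Nat.Properties as ℕ
  open import Data.Integer using (ℤ; _≤_; _≤?_)
  open import Data.Integer.Properties using (≤-trans; ≤-refl; ≤-total)
  import Data.Bool.Properties as Bool
  open import Data.Fin using (Fin; zero; suc; _<_)
  open import Data.Fin.Properties using (any?)
  open import Data.Fin.Subset using (Subset; _∈_; _∉_; _⊆_; _⊂_; ∁; ∣_∣)
  open import Data.Fin.Subset.Properties using (x∈p⇒x∉∁p; x∉p⇒x∈∁p; _∈?_; ⊂-trans; ⊂-irref; p⊂q⇒∣p∣<∣q∣)
  open import Data.List using (List; []; _∷_; length; lookup; cartesianProduct)
  open import Data.Vec.Properties using (≡-dec)
  open import Data.List.Membership.Propositional using () renaming (_∈_ to _∈ₗ_; _∉_ to _∉ₗ_)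
  open import Data.List.Membership.Propositional.Properties using (∈-lookup; ∈-cartesianProduct⁺; ∈-cartesianProduct⁻)
  open import Data.List.Relation.Unary.Any using (here; there)
  open import Data.List.Relation.Unary.All as All using ([]; _∷_)
  open import Data.List.Relation.Unary.AllPairs using (AllPairs; []; _∷_)
  open import Data.List.Relation.Binary.Permutation.Propositional using (_↭_; ↭-refl; ↭-prep; ↭-swap; ↭-trans; ↭-sym)
  open import Data.List.Relation.Binary.Permutation.Propositional.Properties using (∈-resp-↭; All-resp-↭)
  open import Data.Product using (∃; ∃₂; _×_; _,_; proj₁; proj₂)
  open import Data.Sum using (_⊎_; inj₁; inj₂; [_,_]′)
  open import Data.Empty using (⊥-elim)
  open import Function using (_∘_; id)
  open import Induction.WellFounded using (Acc; acc)
  open import Data.Nat.Induction using (<-wellFounded)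
  open import Relation.Nullary using (¬_; Dec; yes; no)
  open import Relation.Nullary.Decidable using (_×-dec_; _→-dec_; ¬?; decidable-stable)
  open import Relation.Binary.PropositionalEquality using (_≡_; _≢_; _≗_; refl; sym; subst)
  open import Defs
  open Separations
  open FiniteSearch
  open Tangles
  open MaximalTangles

  private variable
    m : ℕ
    K V : Subset m
    Cs : List (Subset m)

  -- A ≻ B: A may be listed before B, supersets coming first.
  _≻_ : Subset m → Subset m → Set
  V ≻ W = ∣ W ∣ ℕ.≤ ∣ V ∣ × V ≢ W

  insertBySize : Subset m → List (Subset m) → List (Subset m)
  insertBySize K []       = K ∷ []
  insertBySize K (C ∷ Cs) with ∣ C ∣ ℕ.≤? ∣ K ∣
  ... | yes _ = K ∷ C ∷ Cs
  ... | no  _ = C ∷ insertBySize K Cs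

  insertBySize-↭ : (K : Subset m) (Cs : List (Subset m)) → insertBySize K Cs ↭ K ∷ Cs
  insertBySize-↭ K []       = ↭-refl
  insertBySize-↭ K (C ∷ Cs) with ∣ C ∣ ℕ.≤? ∣ K ∣
  ... | yes _ = ↭-refl
  ... | no  _ = ↭-trans (↭-prep C (insertBySize-↭ K Cs)) (↭-swap C K ↭-refl)

  ∈-insertBySize⁻ : V ∈ₗ insertBySize K Cs → V ≡ K ⊎ V ∈ₗ Cs
  ∈-insertBySize⁻ {K = K} {Cs = Cs} V∈ with ∈-resp-↭ (insertBySize-↭ K Cs) V∈
  ... | here V≡K   = inj₁ V≡K
  ... | there V∈Cs = inj₂ V∈Cs

  ∈-insertBySize-new : K ∈ₗ insertBySize K Cs
  ∈-insertBySize-new {K = K} {Cs = Cs} = ∈-resp-↭ (↭-sym (insertBySize-↭ K Cs)) (here refl)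

  ∈-insertBySize-old : V ∈ₗ Cs → V ∈ₗ insertBySize K Cs
  ∈-insertBySize-old {K = K} V∈Cs = ∈-resp-↭ (↭-sym (insertBySize-↭ K _)) (there V∈Cs)

  insertBySize-sorted : K ∉ₗ Cs → AllPairs _≻_ Cs → AllPairs _≻_ (insertBySize K Cs)
  insertBySize-sorted {Cs = []} _ [] = [] ∷ []
  insertBySize-sorted {K = K} {Cs = C ∷ Cs} K∉ (C≻Cs ∷ sorted) with ∣ C ∣ ℕ.≤? ∣ K ∣
  ... | yes ∣C∣≤∣K∣ = All.tabulate K≻ ∷ C≻Cs ∷ sorted
    where
    K≻ : ∀ {D} → D ∈ₗ C ∷ Cs → K ≻ D
    K≻ (here refl)  = ∣C∣≤∣K∣ , K∉ ∘ here
    K≻ (there D∈Cs) = ℕ.≤-trans (proj₁ (All.lookup C≻Cs D∈Cs)) ∣C∣≤∣K∣ , λ { refl → K∉ (there D∈Cs) }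
  ... | no ∣C∣≰∣K∣ =
    All-resp-↭ (↭-sym (insertBySize-↭ K Cs)) ((ℕ.<⇒≤ (ℕ.≰⇒> ∣C∣≰∣K∣) , λ { refl → K∉ (here refl) }) ∷ C≻Cs)
    ∷ insertBySize-sorted (K∉ ∘ there) sorted

  AllPairs-lookup : ∀ {xs : List (Subset m)} → AllPairs _≻_ xs → ∀ {i j : Fin (length xs)} → i < j → lookup xs i ≻ lookup xs j
  AllPairs-lookup (x≻xs ∷ _)      {zero}  {suc j} _   = All.lookup x≻xs (∈-lookup j)
  AllPairs-lookup (_ ∷ sorted) {suc i} {suc j} i<j = AllPairs-lookup sorted (ℕ.s≤s⁻¹ i<j)

  module Construction {n : ℕ} (f : Subset (suc n) → ℤ) (symmetric : Symmetric f) (submodular : Submodular f) where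

    open Enumeration f

    private variable
      A B C T X Y : Subset (suc n)
      N : List (Subset (suc n))
      𝒫 𝒬 𝒮 : MaximalTangle

    Distinct : MaximalTangle → MaximalTangle → Set
    Distinct 𝒫 𝒬 = ¬ coll 𝒫 ≗ coll 𝒬

    Efficient : Subset (suc n) → MaximalTangle → MaximalTangle → Set
    Efficient T 𝒫 𝒬 = DistinguishesEfficiently f T (coll 𝒫) (coll 𝒬)

    Handled : List (Subset (suc n)) → MaximalTangle → MaximalTangle → Set
    Handled N 𝒫 𝒬 = ∃ λ T → T ∈ₗ N × Efficient T 𝒫 𝒬

    Unhandled : List (Subset (suc n)) → MaximalTangle → MaximalTangle → Set
    Unhandled N 𝒫 𝒬 = Distinct 𝒫 𝒬 × ¬ Handled N 𝒫 𝒬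

    efficient? : ∀ T 𝒫 𝒬 → Dec (Efficient T 𝒫 𝒬)
    efficient? T 𝒫 𝒬 = distinguishes? T (coll 𝒫) (coll 𝒬)
      ×-dec ∀-Subset? (λ B → distinguishes? B (coll 𝒫) (coll 𝒬) →-dec f T ≤? f B)

    handled? : ∀ N 𝒫 𝒬 → Dec (Handled N 𝒫 𝒬)
    handled? N 𝒫 𝒬 = ∃-∈? (λ T → efficient? T 𝒫 𝒬) N

    unhandled? : ∀ N 𝒫 𝒬 → Dec (Unhandled N 𝒫 𝒬)
    unhandled? N 𝒫 𝒬 = ¬? (∀-Subset? λ A → coll 𝒫 A Bool.≟ coll 𝒬 A) ×-dec ¬? (handled? N 𝒫 𝒬)

    CheaperThanUnhandled : List (Subset (suc n)) → Subset (suc n) → Set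
    CheaperThanUnhandled N T = ∀ {𝒫 𝒬} → 𝒫 ∈ₗ maximalTangles → 𝒬 ∈ₗ maximalTangles → Unhandled N 𝒫 𝒬 →
      ∀ B → Distinguishes B (coll 𝒫) (coll 𝒬) → f T ≤ f B

    Topmost : List (Subset (suc n)) → Subset (suc n) → Set
    Topmost N C = ∀ {B} → B ∈ₗ N → ¬ C ⊂ B

    ChildOf : List (Subset (suc n)) → Subset (suc n) → Subset (suc n) → Set
    ChildOf N A C = C ⊂ A × (∀ {D} → D ∈ₗ N → ¬ (C ⊂ D × D ⊂ A))

    LivesAtRoot : List (Subset (suc n)) → MaximalTangle → Set
    LivesAtRoot N R = ∀ {C} → C ∈ₗ N → Topmost N C → Small (coll R) C

    LivesBelow : List (Subset (suc n)) → Subset (suc n) → MaximalTangle → Set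
    LivesBelow N A R = Big (coll R) A × (∀ {C} → C ∈ₗ N → ChildOf N A C → Small (coll R) C)

    -- N will be the list of edge separations S(X_{suc i}) of the tree, each represented by its side
    -- avoiding 0 (which makes N laminar); root-tangle and node-tangle supply the tangles living in its parts.
    record Invariant (N : List (Subset (suc n))) : Set where
      field
        avoid-zero  : ∀ {A} → A ∈ₗ N → zero ∉ A
        nested      : ∀ {A B} → A ∈ₗ N → B ∈ₗ N → Nested A B
        sorted      : AllPairs _≻_ N
        efficient   : ∀ {T} → T ∈ₗ N → ∃₂ (Efficient T)
        cheap       : ∀ {T} → T ∈ₗ N → CheaperThanUnhandled N T
        root-tangle : ∃ (LivesAtRoot N)
        node-tangle : ∀ {A} → A ∈ₗ N → ∃ (LivesBelow N A)

    efficient-side : IsSide T Y → Efficient T 𝒫 𝒬 → Efficient Y 𝒫 𝒬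
    efficient-side (inj₁ refl) = id
    efficient-side (inj₂ refl) = efficiently-∁ symmetric

    module Step {N} (I : Invariant N) {𝒫₀ 𝒬₀} (𝒫₀∈ : 𝒫₀ ∈ₗ maximalTangles) (𝒬₀∈ : 𝒬₀ ∈ₗ maximalTangles)
      (unhandled₀ : Unhandled N 𝒫₀ 𝒬₀) {B₀} (B₀-distinguishes : Distinguishes B₀ (coll 𝒫₀) (coll 𝒬₀))
      (B₀-cheapest : CheaperThanUnhandled N B₀) where

      open Invariant I

      private
        module P₀ = Tangle symmetric (tangle 𝒫₀)
        module Q₀ = Tangle symmetric (tangle 𝒬₀)

      Distinguishes₀ : Subset (suc n) → Set
      Distinguishes₀ X = Distinguishes X (coll 𝒫₀) (coll 𝒬₀)

      ≤order-𝒫₀ : Distinguishes₀ X → f X ≤ order 𝒫₀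
      ≤order-𝒫₀ (inj₁ (sP , _)) = P₀.Small⇒≤ sP
      ≤order-𝒫₀ (inj₂ (bP , _)) = P₀.Big⇒≤ bP

      ≤order-𝒬₀ : Distinguishes₀ X → f X ≤ order 𝒬₀
      ≤order-𝒬₀ (inj₁ (_ , bQ)) = Q₀.Big⇒≤ bQ
      ≤order-𝒬₀ (inj₂ (_ , sQ)) = Q₀.Small⇒≤ sQ

      member-cheap : C ∈ₗ N → ∀ B → Distinguishes₀ B → f C ≤ f B
      member-cheap C∈N = cheap C∈N 𝒫₀∈ 𝒬₀∈ unhandled₀

      SmallInBoth BigInBoth : Subset (suc n) → Set
      SmallInBoth C = Small (coll 𝒫₀) C × Small (coll 𝒬₀) C
      BigInBoth   C = Big (coll 𝒫₀) C × Big (coll 𝒬₀) C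

      -- A member of N that 𝒫₀ and 𝒬₀ oriented differently would distinguish them efficiently.
      member-alike : C ∈ₗ N → SmallInBoth C ⊎ BigInBoth C
      member-alike C∈N
        with P₀.small-or-big (≤-trans (member-cheap C∈N B₀ B₀-distinguishes) (≤order-𝒫₀ B₀-distinguishes))
           | Q₀.small-or-big (≤-trans (member-cheap C∈N B₀ B₀-distinguishes) (≤order-𝒬₀ B₀-distinguishes))
      ... | inj₁ sP | inj₁ sQ = inj₁ (sP , sQ)
      ... | inj₂ bP | inj₂ bQ = inj₂ (bP , bQ)
      ... | inj₁ sP | inj₂ bQ = ⊥-elim (proj₂ unhandled₀ (_ , C∈N , inj₁ (sP , bQ) , member-cheap C∈N))
      ... | inj₂ bP | inj₁ sQ = ⊥-elim (proj₂ unhandled₀ (_ , C∈N , inj₂ (bP , sQ) , member-cheap C∈N))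

      big-side : T ∈ₗ N → ∃ λ Y → IsSide T Y × Big (coll 𝒫₀) Y × Big (coll 𝒬₀) Y
      big-side T∈N with member-alike T∈N
      ... | inj₂ (bP , bQ) = _ , inj₁ refl , bP , bQ
      ... | inj₁ (sP , sQ) = _ , inj₂ refl , Small⇒Big∁ (coll 𝒫₀) sP , Small⇒Big∁ (coll 𝒬₀) sQ

      Candidate : Subset (suc n) → Set
      Candidate X = Distinguishes₀ X × f X ≤ f B₀

      crossings : Subset (suc n) → ℕ
      crossings X = count (λ T → ¬? (nested? T X)) N

      uncross-member : Candidate X → T ∈ₗ N → ¬ Nested T X → ∃ λ Z → Candidate Z × crossings Z ℕ.< crossings X
      uncross-member {X} {T} (dX , fX≤) T∈N T⋈X
        with Y , side , bPY , bQY ← big-side T∈N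
           | 𝒫′ , 𝒬′ , T-efficient ← efficient T∈N
        with Z , corner , dZ , fZ≤fX ← uncross symmetric submodular (tangle 𝒫′) (tangle 𝒬′) (tangle 𝒫₀) (tangle 𝒬₀)
                                                 dX bPY bQY (efficient-side {𝒫 = 𝒫′} {𝒬′} side T-efficient)
        = Z , (dZ , ≤-trans fZ≤fX fX≤) ,
          count-mono-< (λ U → ¬? (nested? U Z)) (λ U → ¬? (nested? U X)) N
            (λ U∈N U⋈Z U∥X → U⋈Z (nested-corner (crosses-side side T⋈X) U∥X (nested-side⁺ side (nested U∈N T∈N)) corner))
            T∈N (λ T⋈Z → T⋈Z (⊆-side⇒nested side (corner⊆ corner))) T⋈X

      uncross-all : Candidate X → Acc ℕ._<_ (crossings X) → ∃ λ S → Candidate S × (∀ {T} → T ∈ₗ N → Nested T S)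
      uncross-all {X} candidate (acc rec) with ∃-∈? (λ T → ¬? (nested? T X)) N
      ... | no none = X , candidate , λ {T} T∈N → decidable-stable (nested? T X) (none ∘ (T ,_) ∘ (T∈N ,_))
      ... | yes (T , T∈N , T⋈X) with _ , candidate′ , fewer ← uncross-member candidate T∈N T⋈X =
        uncross-all candidate′ (rec fewer)

      record Uncrossed : Set where
        field
          S               : Subset (suc n)
          S-distinguishes : Distinguishes₀ S
          S≤B₀            : f S ≤ f B₀
          S-nested        : ∀ {T} → T ∈ₗ N → Nested T S
          0∉S             : zero ∉ S

      uncrossed : Uncrossed
      uncrossed with uncross-all (B₀-distinguishes , ≤-refl) (<-wellFounded _)
      ... | S , (dS , fS≤) , S-nested with zero ∈? S
      ...   | no 0∉S = record { S = S ; S-distinguishes = dS ; S≤B₀ = fS≤ ; S-nested = S-nested ; 0∉S = 0∉S }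
      ...   | yes 0∈S = record
        { S = ∁ S ; S-distinguishes = distinguishes-∁ {𝒫 = coll 𝒫₀} {coll 𝒬₀} dS
        ; S≤B₀ = subst (_≤ f B₀) (symmetric S) fS≤ ; S-nested = nested-∁ʳ ∘ S-nested ; 0∉S = x∈p⇒x∉∁p 0∈S }

      open Uncrossed uncrossed public

      S-efficient : Efficient S 𝒫₀ 𝒬₀
      S-efficient = S-distinguishes , λ B dB → ≤-trans S≤B₀ (B₀-cheapest 𝒫₀∈ 𝒬₀∈ unhandled₀ B dB)

      S∉N : S ∉ₗ N
      S∉N S∈N = proj₂ unhandled₀ (S , S∈N , S-efficient)

      N′ : List (Subset (suc n))
      N′ = insertBySize S N

      S∈N′ : S ∈ₗ N′
      S∈N′ = ∈-insertBySize-new {K = S} {Cs = N}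

      N⊆N′ : C ∈ₗ N → C ∈ₗ N′
      N⊆N′ = ∈-insertBySize-old {K = S}

      ∈N′-elim : (P : Subset (suc n) → Set) → P S → (∀ {C} → C ∈ₗ N → P C) → ∀ {C} → C ∈ₗ N′ → P C
      ∈N′-elim P pS pN C∈N′ with ∈-insertBySize⁻ {K = S} {Cs = N} C∈N′
      ... | inj₁ refl = pS
      ... | inj₂ C∈N  = pN C∈N

      handled₀ : Handled N′ 𝒫₀ 𝒬₀
      handled₀ = S , S∈N′ , S-efficient

      unhandled-shrinks : Unhandled N′ 𝒫 𝒬 → Unhandled N 𝒫 𝒬
      unhandled-shrinks (distinct , unhandled) = distinct , λ (T , T∈N , T-eff) → unhandled (T , N⊆N′ T∈N , T-eff)

      topmost-shrinks : Topmost N′ C → Topmost N C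
      topmost-shrinks top = top ∘ N⊆N′

      child-shrinks : ChildOf N′ A C → ChildOf N A C
      child-shrinks (C⊂A , between) = C⊂A , between ∘ N⊆N′

      nested-S : A ∈ₗ N′ → Nested S A
      nested-S = ∈N′-elim (Nested S) nested-refl (nested-sym ∘ S-nested)

      data Location : Set where
        at-root : (∀ {C} → C ∈ₗ N → SmallInBoth C) → Location
        below   : A ∈ₗ N → BigInBoth A → (∀ {C} → C ∈ₗ N → C ⊂ A → SmallInBoth C) → Location

      -- S goes below the smallest member of N that is big in 𝒫₀ (and then in 𝒬₀), if any.
      location : Location
      location with BySize.minimal? (λ C → small? (coll 𝒫₀) (∁ C)) N
        where module BySize = Minimum (λ A B → ∣ A ∣ ℕ.≤ ∣ B ∣) (λ A B → ℕ.≤-total ∣ A ∣ ∣ B ∣) ℕ.≤-trans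
      ... | inj₁ none = at-root λ C∈N → [ id , (λ (bPC , _) → ⊥-elim (none C∈N bPC)) ]′ (member-alike C∈N)
      ... | inj₂ (A , A∈N , bPA , A-min) with member-alike A∈N
      ...   | inj₁ (sPA , _) = ⊥-elim (P₀.small∧big⇒⊥ sPA bPA)
      ...   | inj₂ bothA = below A∈N bothA λ C∈N C⊂A →
        [ id , (λ (bPC , _) → ⊥-elim (ℕ.<⇒≱ (p⊂q⇒∣p∣<∣q∣ C⊂A) (A-min C∈N bPC))) ]′ (member-alike C∈N)

      small-in : (𝒮 ≡ 𝒫₀ ⊎ 𝒮 ≡ 𝒬₀) → SmallInBoth C → Small (coll 𝒮) C
      small-in (inj₁ refl) = proj₁
      small-in (inj₂ refl) = proj₂

      big-in : (𝒮 ≡ 𝒫₀ ⊎ 𝒮 ≡ 𝒬₀) → BigInBoth C → Big (coll 𝒮) C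
      big-in (inj₁ refl) = proj₁
      big-in (inj₂ refl) = proj₂

      module Insertion {𝒲 𝒱} (𝒲₀ : 𝒲 ≡ 𝒫₀ ⊎ 𝒲 ≡ 𝒬₀) (𝒱₀ : 𝒱 ≡ 𝒫₀ ⊎ 𝒱 ≡ 𝒬₀)
                       (S-small : Small (coll 𝒲) S) (S-big : Big (coll 𝒱) S) where

        private
          module 𝒲 = Tangle symmetric (tangle 𝒲)
          module 𝒱 = Tangle symmetric (tangle 𝒱)

        S-nonempty : ∃ (_∈ S)
        S-nonempty with any? (_∈? S)
        ... | yes x∈S = x∈S
        ... | no  none = ⊥-elim (𝒱.uncovered S-big S-big S-big λ x → inj₁ (x∉p⇒x∈∁p (none ∘ (x ,_))))

        no-small-superset : Small (coll 𝒱) B → ¬ S ⊆ B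
        no-small-superset sB S⊆B = 𝒱.small∧big⇒⊥ (𝒱.Small-⊆ S⊆B sB (𝒱.Big⇒≤ S-big)) S-big

        no-big-subset : Big (coll 𝒲) A → ¬ A ⊆ S
        no-big-subset bA A⊆S = 𝒲.small∧big⇒⊥ S-small (𝒲.Big-⊇ A⊆S bA (𝒲.Small⇒≤ S-small))

        ⊂-big-member : A ∈ₗ N → BigInBoth A → S ⊂ A
        ⊂-big-member A∈N bothA with nested⇒laminar 0∉S (avoid-zero A∈N) (nested-sym (S-nested A∈N))
        ... | inj₁ S⊆A          = ⊆∧⊉⇒⊂ S⊆A (no-big-subset (big-in 𝒲₀ bothA))
        ... | inj₂ (inj₁ A⊆S)   = ⊥-elim (no-big-subset (big-in 𝒲₀ bothA) A⊆S)
        ... | inj₂ (inj₂ apart) = ⊥-elim (no-small-superset (big-in 𝒱₀ bothA) (x∉p⇒x∈∁p ∘ apart))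

        root-tangle′ : Location → ∃ (LivesAtRoot N′)
        root-tangle′ (at-root all-small) =
          𝒲 , ∈N′-elim (λ C → Topmost N′ C → Small (coll 𝒲) C)
                       (λ _ → S-small) (λ C∈N _ → small-in 𝒲₀ (all-small C∈N))
        root-tangle′ (below A∈N bothA _) with R , R-root ← root-tangle =
          R , ∈N′-elim (λ C → Topmost N′ C → Small (coll R) C)
                       (λ S-top → ⊥-elim (S-top (N⊆N′ A∈N) (⊂-big-member A∈N bothA)))
                       (λ C∈N → R-root C∈N ∘ topmost-shrinks)

        node-unchanged : B ∈ₗ N → ¬ ChildOf N′ B S → ∃ (LivesBelow N′ B)
        node-unchanged {B} B∈N S-not-child with R , bRB , R-children ← node-tangle B∈N =
          R , bRB , ∈N′-elim (λ C → ChildOf N′ B C → Small (coll R) C)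
                             (⊥-elim ∘ S-not-child) (λ C∈N → R-children C∈N ∘ child-shrinks)

        inside-S : Location → C ∈ₗ N → C ⊂ S → SmallInBoth C
        inside-S (at-root all-small)  C∈N _   = all-small C∈N
        inside-S (below A∈N bothA inside) C∈N C⊂S = inside C∈N (⊂-trans C⊂S (⊂-big-member A∈N bothA))

        node-S : Location → ∃ (LivesBelow N′ S)
        node-S loc = 𝒱 , S-big , ∈N′-elim (λ C → ChildOf N′ S C → Small (coll 𝒱) C)
                                          (λ (S⊂S , _) → ⊥-elim (⊂-irref refl S⊂S))
                                          (λ C∈N (C⊂S , _) → small-in 𝒱₀ (inside-S loc C∈N C⊂S))

        not-child-of-other : A ∈ₗ N → BigInBoth A → (∀ {C} → C ∈ₗ N → C ⊂ A → SmallInBoth C) →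
          B ∈ₗ N → B ≢ A → ¬ ChildOf N′ B S
        not-child-of-other A∈N bothA inside B∈N B≢A (S⊂B , nothing-between)
          with nested⇒laminar (avoid-zero B∈N) (avoid-zero A∈N) (nested B∈N A∈N)
        ... | inj₁ B⊆A          = no-small-superset (small-in 𝒱₀ (inside B∈N (⊆∧≢⇒⊂ B⊆A B≢A))) (proj₁ S⊂B)
        ... | inj₂ (inj₁ A⊆B)   = nothing-between (N⊆N′ A∈N) (⊂-big-member A∈N bothA , ⊆∧≢⇒⊂ A⊆B (B≢A ∘ sym))
        ... | inj₂ (inj₂ apart) with x , x∈S ← S-nonempty = apart (proj₁ S⊂B x∈S) (proj₁ (⊂-big-member A∈N bothA) x∈S)

        node-old : Location → B ∈ₗ N → ∃ (LivesBelow N′ B)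
        node-old (at-root all-small) B∈N =
          node-unchanged B∈N λ (S⊂B , _) → no-small-superset (small-in 𝒱₀ (all-small B∈N)) (proj₁ S⊂B)
        node-old {B} (below {A} A∈N bothA inside) B∈N with ≡-dec Bool._≟_ B A
        ... | yes refl = 𝒲 , big-in 𝒲₀ bothA ,
          ∈N′-elim (λ C → ChildOf N′ A C → Small (coll 𝒲) C)
                   (λ _ → S-small) (λ C∈N (C⊂A , _) → small-in 𝒲₀ (inside C∈N C⊂A))
        ... | no  B≢A  = node-unchanged B∈N (not-child-of-other A∈N bothA inside B∈N B≢A)

        node-tangle′ : Location → B ∈ₗ N′ → ∃ (LivesBelow N′ B)
        node-tangle′ loc = ∈N′-elim (λ B → ∃ (LivesBelow N′ B)) (node-S loc) (node-old loc)

      split : ∃₂ λ 𝒲 𝒱 → (𝒲 ≡ 𝒫₀ ⊎ 𝒲 ≡ 𝒬₀) × (𝒱 ≡ 𝒫₀ ⊎ 𝒱 ≡ 𝒬₀) × Small (coll 𝒲) S × Big (coll 𝒱) S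
      split with S-distinguishes
      ... | inj₁ (sP , bQ) = 𝒫₀ , 𝒬₀ , inj₁ refl , inj₂ refl , sP , bQ
      ... | inj₂ (bP , sQ) = 𝒬₀ , 𝒫₀ , inj₂ refl , inj₁ refl , sQ , bP

      nested′ : A ∈ₗ N′ → B ∈ₗ N′ → Nested A B
      nested′ {A} {B} A∈N′ B∈N′ = ∈N′-elim (λ A → Nested A B) (nested-S B∈N′)
        (λ {A} A∈N → ∈N′-elim (Nested A) (S-nested A∈N) (nested A∈N) B∈N′) A∈N′

      invariant′ : Invariant N′
      invariant′ with _ , _ , 𝒲₀ , 𝒱₀ , S-small , S-big ← split = record
        { avoid-zero  = ∈N′-elim (zero ∉_) 0∉S avoid-zero
        ; nested      = nested′
        ; sorted      = insertBySize-sorted S∉N sorted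
        ; efficient   = ∈N′-elim (λ T → ∃₂ (Efficient T)) (𝒫₀ , 𝒬₀ , S-efficient) efficient
        ; cheap       = ∈N′-elim (CheaperThanUnhandled N′)
                          (λ {𝒫} {𝒬} 𝒫∈ 𝒬∈ u B dB →
                             ≤-trans S≤B₀ (B₀-cheapest 𝒫∈ 𝒬∈ (unhandled-shrinks {𝒫} {𝒬} u) B dB))
                          (λ T∈N {𝒫} {𝒬} 𝒫∈ 𝒬∈ → cheap T∈N 𝒫∈ 𝒬∈ ∘ unhandled-shrinks {𝒫} {𝒬})
        ; root-tangle = Insertion.root-tangle′ 𝒲₀ 𝒱₀ S-small S-big location
        ; node-tangle = Insertion.node-tangle′ 𝒲₀ 𝒱₀ S-small S-big location
        }

    Complete : List (Subset (suc n)) → Set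
    Complete N = ∀ {𝒫 𝒬} → 𝒫 ∈ₗ maximalTangles → 𝒬 ∈ₗ maximalTangles → Distinct 𝒫 𝒬 → Handled N 𝒫 𝒬

    pairs : List (MaximalTangle × MaximalTangle)
    pairs = cartesianProduct maximalTangles maximalTangles

    unhandledPairs : List (Subset (suc n)) → ℕ
    unhandledPairs N = count (λ (𝒫 , 𝒬) → unhandled? N 𝒫 𝒬) pairs

    Witness : List (Subset (suc n)) → (MaximalTangle × MaximalTangle) × Subset (suc n) → Set
    Witness N ((𝒫 , 𝒬) , B) = Unhandled N 𝒫 𝒬 × Distinguishes B (coll 𝒫) (coll 𝒬)

    witness? : ∀ N t → Dec (Witness N t)
    witness? N ((𝒫 , 𝒬) , B) = unhandled? N 𝒫 𝒬 ×-dec distinguishes? B (coll 𝒫) (coll 𝒬)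

    private
      Triple : Set
      Triple = (MaximalTangle × MaximalTangle) × Subset (suc n)

      module Cheapest = Minimum {A = Triple} (λ t u → f (proj₂ t) ≤ f (proj₂ u))
                                             (λ t u → ≤-total (f (proj₂ t)) (f (proj₂ u))) ≤-trans

    triples : List ((MaximalTangle × MaximalTangle) × Subset (suc n))
    triples = cartesianProduct pairs (subsets (suc n))

    ∈-triples : 𝒫 ∈ₗ maximalTangles → 𝒬 ∈ₗ maximalTangles → ∀ B → ((𝒫 , 𝒬) , B) ∈ₗ triples
    ∈-triples 𝒫∈ 𝒬∈ B = ∈-cartesianProduct⁺ (∈-cartesianProduct⁺ 𝒫∈ 𝒬∈) (∈-subsets B)

    build : Invariant N → Acc ℕ._<_ (unhandledPairs N) → ∃ λ N → Invariant N × Complete N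
    build {N} I (acc rec) with ∃-∈? (witness? N) triples
    ... | no none = N , I , λ {𝒫} {𝒬} 𝒫∈ 𝒬∈ distinct → decidable-stable (handled? N 𝒫 𝒬) λ unhandled →
      let A , dA = distinguishable (proj₂ 𝒫) (proj₂ 𝒬) distinct
      in none (_ , ∈-triples 𝒫∈ 𝒬∈ A , (distinct , unhandled) , dA)
    ... | yes (_ , t∈ , ok)
      with ((𝒫₀ , 𝒬₀) , B₀) , t₀∈ , (unhandled₀ , dB₀) , cheapest ← Cheapest.minimal (witness? N) triples t∈ ok
      with 𝒫₀∈ , 𝒬₀∈ ← ∈-cartesianProduct⁻ maximalTangles maximalTangles (proj₁ (∈-cartesianProduct⁻ pairs _ t₀∈)) =
      build (Step.invariant′ I 𝒫₀∈ 𝒬₀∈ unhandled₀ dB₀ B₀-cheapest) (rec fewer)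
      where
      B₀-cheapest : CheaperThanUnhandled N B₀
      B₀-cheapest {𝒫} {𝒬} 𝒫∈ 𝒬∈ u B dB = cheapest (∈-triples 𝒫∈ 𝒬∈ B) (u , dB)
      open Step I 𝒫₀∈ 𝒬₀∈ unhandled₀ dB₀ B₀-cheapest using (N′; handled₀; unhandled-shrinks)
      fewer : unhandledPairs N′ ℕ.< unhandledPairs N
      fewer = count-mono-< _ _ pairs (λ {(𝒫 , 𝒬)} _ → unhandled-shrinks {𝒫} {𝒬}) (∈-cartesianProduct⁺ 𝒫₀∈ 𝒬₀∈)
                (λ u → proj₂ u handled₀) unhandled₀

    invariant₀ : Invariant []
    invariant₀ = record
      { avoid-zero = λ () ; nested = λ () ; sorted = [] ; efficient = λ () ; cheap = λ ()
      ; root-tangle = proj₁ maximalTangle-exists , λ () ; node-tangle = λ () }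

    abstract
      complete-family : ∃ λ N → Invariant N × Complete N
      complete-family = build invariant₀ (<-wellFounded _)

open import Data.Nat as ℕ using (ℕ; zero; suc)
import Data.Nat.Properties as ℕ
open import Data.Integer using (ℤ)
open import Data.Bool using (true; false)
open import Data.Fin using (Fin; zero; suc; _<_)
open import Data.Fin.Properties using (<-cmp)
open import Data.Fin.Subset using (Subset; _∈_; _∉_; _⊆_; _⊂_; ∁)
open import Data.Fin.Subset.Properties using (p⊂q⇒∣p∣<∣q∣; ⊂-irref)
open import Data.Vec using ([])
open import Data.List using (List; length; lookup)
open import Data.List.Membership.Propositional using () renaming (_∈_ to _∈ₗ_)
open import Data.List.Membership.Propositional.Properties using (∈-lookup)
open import Data.List.Relation.Unary.Any using (index)
open import Data.List.Relation.Unary.Any.Properties using (lookup-index)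
open import Data.Product using (Σ; ∃; _×_; _,_; proj₁; proj₂)
open import Data.Sum using (_⊎_; inj₁)
open import Data.Empty using (⊥-elim)
open import Function using (_∘_)
open import Relation.Nullary using (¬_)
open import Relation.Binary.Definitions using (tri<; tri≈; tri>)
open import Relation.Binary.PropositionalEquality using (_≡_; refl; sym; trans; subst)
open import Defs
open Separations
open FiniteSearch
open Tangles
open MaximalTangles
open Trees
open TreeOfTangles

TangleTree : (n : ℕ) → (Subset n → ℤ) → Set
TangleTree n f =
  Σ (TreeDecomposition n) λ T →
    (∀ 𝒫 𝒬 → IsMaximalTangle f 𝒫 → IsMaximalTangle f 𝒬 → ¬ (∀ A → 𝒫 A ≡ 𝒬 A) →
       TreeDecomposition.DistinguishesEfficientlyTD T f 𝒫 𝒬)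
    × (∀ t → ∃ λ 𝒬 → IsMaximalTangle f 𝒬 × TreeDecomposition.LivesIn T 𝒬 t)

-- On the empty ground set [] = ∁ [], so no tangle has a small side and one vertex suffices.
tangleTree-empty : (f : Subset 0 → ℤ) → TangleTree 0 f
tangleTree-empty f = record { m = 0 ; par = λ () ; par< = λ () ; part = λ () }
                   , (λ 𝒫 𝒬 max𝒫 max𝒬 𝒫≉𝒬 →
                        ⊥-elim (𝒫≉𝒬 λ { [] → trans (nothing-small max𝒫) (sym (nothing-small max𝒬)) }))
                   , λ { zero → coll 𝒬 , proj₂ 𝒬 , (λ ()) , (λ ()) }
  where
  open Enumeration f
  𝒬 = proj₁ maximalTangle-exists
  nothing-small : ∀ {𝒮} → IsMaximalTangle f 𝒮 → 𝒮 [] ≡ false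
  nothing-small {𝒮} ((_ , T) , _) with 𝒮 [] in 𝒮[]
  ... | false = refl
  ... | true  = ⊥-elim (IsTangle.exclusive T [] (𝒮[] , 𝒮[]))

module _ {n : ℕ} (f : Subset (suc n) → ℤ) (symmetric : Symmetric f) (submodular : Submodular f) where

  open Enumeration f
  open Construction f symmetric submodular

  private
    N : List (Subset (suc n))
    N = proj₁ complete-family

    open Invariant (proj₁ (proj₂ complete-family))

    complete : Complete N
    complete = proj₂ (proj₂ complete-family)

    M : Fin (length N) → Subset (suc n)
    M = lookup N

    laminar : ∀ i j → M i ⊆ M j ⊎ M j ⊆ M i ⊎ (∀ {x} → x ∈ M i → x ∉ M j)
    laminar i j = nested⇒laminar (avoid-zero (∈-lookup i)) (avoid-zero (∈-lookup j)) (nested (∈-lookup i) (∈-lookup j))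

    M-injective : ∀ {i j} → M i ≡ M j → i ≡ j
    M-injective {i} {j} Mi≡Mj with <-cmp i j
    ... | tri< i<j _ _ = ⊥-elim (proj₂ (AllPairs-lookup sorted i<j) Mi≡Mj)
    ... | tri≈ _ i≡j _ = i≡j
    ... | tri> _ _ j<i = ⊥-elim (proj₂ (AllPairs-lookup sorted j<i) (sym Mi≡Mj))

    ⊂⇒> : ∀ {i j} → M i ⊂ M j → j < i
    ⊂⇒> {i} {j} Mi⊂Mj with <-cmp i j
    ... | tri< i<j _ _ = ⊥-elim (ℕ.<⇒≱ (p⊂q⇒∣p∣<∣q∣ Mi⊂Mj) (proj₁ (AllPairs-lookup sorted i<j)))
    ... | tri≈ _ refl _ = ⊥-elim (⊂-irref refl Mi⊂Mj)
    ... | tri> _ _ j<i = j<i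

  open LaminarTree M laminar M-injective ⊂⇒>
  open TreeDecomposition tree using (below; par; LivesIn; DistinguishesEfficientlyTD)

  private
    index-of : ∀ {T} → T ∈ₗ N → ∃ λ i → T ≡ M i
    index-of T∈N = index T∈N , lookup-index T∈N

    Small⇒Big∁below : (𝒮 : Collection (suc n)) (i : Fin (length N)) → Small 𝒮 (M i) → Big 𝒮 (∁ (below i))
    Small⇒Big∁below 𝒮 i = subst (λ A → Big 𝒮 (∁ A)) (sym (below≡M i)) ∘ Small⇒Big∁ {A = M i} 𝒮

  distinguishes-efficiently : ∀ 𝒫 𝒬 → IsMaximalTangle f 𝒫 → IsMaximalTangle f 𝒬 → ¬ (∀ A → 𝒫 A ≡ 𝒬 A) →
    DistinguishesEfficientlyTD f 𝒫 𝒬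
  distinguishes-efficiently 𝒫 𝒬 max𝒫 max𝒬 𝒫≉𝒬
    with 𝒫′ , 𝒫′∈ , 𝒫≗𝒫′ ← ∈-maximalTangles max𝒫
       | 𝒬′ , 𝒬′∈ , 𝒬≗𝒬′ ← ∈-maximalTangles max𝒬
    with T , T∈N , dT , T-min ← complete 𝒫′∈ 𝒬′∈ (λ 𝒫′≗𝒬′ → 𝒫≉𝒬 λ A → trans (𝒫≗𝒫′ A) (trans (𝒫′≗𝒬′ A) (sym (𝒬≗𝒬′ A))))
    with i , refl ← index-of T∈N
    = M i , (i , inj₁ (sym (below≡M i))) ,
      Distinguishes-≗ (sym ∘ 𝒫≗𝒫′) (sym ∘ 𝒬≗𝒬′) dT , λ B → T-min B ∘ Distinguishes-≗ 𝒫≗𝒫′ 𝒬≗𝒬′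

  lives-at-root : ∃ λ 𝒬 → IsMaximalTangle f 𝒬 × LivesIn 𝒬 zero
  lives-at-root with R , R-root ← root-tangle =
    coll R , proj₂ R , (λ _ ()) , λ i par≡0 → Small⇒Big∁below (coll R) i (R-root (∈-lookup i) (topmost i par≡0))
    where
    topmost : ∀ i → par i ≡ zero → Topmost N (M i)
    topmost i par≡0 B∈N Mi⊂B with l , refl ← index-of B∈N = parent-zero i par≡0 l Mi⊂B

  lives-at : ∀ j → ∃ λ 𝒬 → IsMaximalTangle f 𝒬 × LivesIn 𝒬 (suc j)
  lives-at j with R , bR , R-children ← node-tangle (∈-lookup j) =
    coll R , proj₂ R , (λ { i refl → subst (Big (coll R)) (sym (below≡M i)) bR })
                     , λ i par≡j → Small⇒Big∁below (coll R) i (R-children (∈-lookup i) (child i par≡j))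
    where
    child : ∀ i → par i ≡ suc j → ChildOf N (M j) (M i)
    child i par≡j = proj₁ (parent-suc i j par≡j) , not-between
      where
      not-between : ∀ {D} → D ∈ₗ N → ¬ (M i ⊂ D × D ⊂ M j)
      not-between D∈N with l , refl ← index-of D∈N = proj₂ (parent-suc i j par≡j) l

  tangleTree-nonempty : TangleTree (suc n) f
  tangleTree-nonempty = tree , distinguishes-efficiently , λ { zero → lives-at-root ; (suc j) → lives-at j }

corollary4p3 : (n : ℕ) (f : Subset n → ℤ) → Symmetric f → Submodular f →
    Σ (TreeDecomposition n) λ T →
      (∀ 𝒫 𝒬 → IsMaximalTangle f 𝒫 → IsMaximalTangle f 𝒬 →
         ¬ (∀ A → 𝒫 A ≡ 𝒬 A) →
         TreeDecomposition.DistinguishesEfficientlyTD T f 𝒫 𝒬)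
      × (∀ t → ∃ λ 𝒬 → IsMaximalTangle f 𝒬 × TreeDecomposition.LivesIn T 𝒬 t)
corollary4p3 zero    f _         _          = tangleTree-empty f
corollary4p3 (suc n) f symmetric submodular = tangleTree-nonempty f symmetric submodular
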